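{- Let $n \geq 26$ and $4 \leq a \leq n-2$ be integers. Then $W(F_{n,a}) \leq W(C_{n,3})$, and equality holds only if $a=4$ or $a=n-2$.
   Context: All graphs are finite and simple. For a connected graph $G$, the Wiener index is $W(G)=\sum_{\{u,v\}\subseteq V(G)} d_G(u,v)$, summing the shortest-path distances over all unordered pairs of distinct vertices. For integers $3\leq a\leq n-1$, $F_{n,a}$ is the graph of order $n$ obtained from disjoint cycles $C_a$ and $C_{n+2-a}$ as follows: choose two adjacent vertices $u,v$ of $C_a$ and two adjacent vertices $u',v'$ of $C_{n+2-a}$, then identify $u$ with $u'$ and $v$ with $v'$ (so the two cycles share the edge $uv$). For $n\ge 5$, $C_{n,3}$ is the graph of order $n$ obtained from disjoint cycles $C_3$ and $C_{n-2}$ by identifying one vertex of $C_3$ with one vertex of $C_{n-2}$. -}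

module Defs where

open import Data.Nat using (ℕ; zero; suc; _+_; _∸_; _<ᵇ_; _≡ᵇ_)
open import Data.Bool using (Bool; true; false; _∧_; _∨_; if_then_else_)
open import Data.List using (List; []; _∷_; _++_; map; upTo; concatMap)
open import Data.Bool.ListAction using (any)
open import Data.Nat.ListAction using (sum)
open import Data.Product using (_×_; _,_)

-- A finite simple graph of order n: vertex set {0,…,n-1}, given by a list of
-- (undirected) edges.  Adjacency is the symmetric closure of the edge list.
record Graph : Set where
  constructor graph
  field
    order : ℕ
    edges : List (ℕ × ℕ)
open Graph public

adj : Graph → ℕ → ℕ → Bool
adj G x y = any (λ { (p , q) → ((p ≡ᵇ x) ∧ (q ≡ᵇ y)) ∨ ((p ≡ᵇ y) ∧ (q ≡ᵇ x)) }) (edges G)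

reach : Graph → ℕ → ℕ → ℕ → Bool
reach G zero    x y = x ≡ᵇ y
reach G (suc k) x y = reach G k x y ∨ any (λ z → reach G k x z ∧ adj G z y) (upTo (order G))

-- Shortest-path distance: the least k ≤ order such that a walk of length ≤ k
-- exists (for connected graphs a shortest path has length < order, so the
-- search bound is never hit).
distFrom : Graph → ℕ → ℕ → ℕ → ℕ → ℕ
distFrom G k zero    x y = k
distFrom G k (suc f) x y = if reach G k x y then k else distFrom G (suc k) f x y

dist : Graph → ℕ → ℕ → ℕ
dist G x y = distFrom G 0 (order G) x y

wiener : Graph → ℕ
wiener G = sum (concatMap (λ y → map (λ x → dist G x y) (upTo y)) (upTo (order G)))

pathEdges : ℕ → ℕ → List (ℕ × ℕ)
pathEdges s zero = []
pathEdges s (suc m) = (s , suc s) ∷ pathEdges (suc s) m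

-- F_{n,a}: cycle C_a = 0-1-…-(a-1)-0 and cycle C_{n+2-a} = 0-1-a-(a+1)-…-(n-1)-0,
-- sharing the edge {0,1}.
F : ℕ → ℕ → Graph
F n a = graph n
  (pathEdges 0 (a ∸ 1) ++ ((a ∸ 1) , 0) ∷ (1 , a) ∷ pathEdges a (n ∸ 1 ∸ a) ++ ((n ∸ 1) , 0) ∷ [])

-- C_{n,3}: cycle C_{n-2} = 0-1-…-(n-3)-0 and triangle 0,(n-2),(n-1), sharing vertex 0.
C3 : ℕ → Graph
C3 n = graph n
  (pathEdges 0 (n ∸ 3) ++ ((n ∸ 3) , 0) ∷ (0 , (n ∸ 2)) ∷ ((n ∸ 2) , (n ∸ 1)) ∷ ((n ∸ 1) , 0) ∷ [])

module Submission where

{-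
Both graphs are two cycles glued together: F_{n,a} glues C_a and C_{n+2-a} along the edge
{0,1}, and C_{n,3} glues C_{n-2} and C_3 at the vertex 0. In such a gluing the distance
between two vertices of the same cycle is their distance on that cycle, and otherwise it is
the shorter of the routes through the shared vertices; this candidate is checked against the
breadth-first characterisation of the distance. Summing, with p = a - 2 and q = n - a,

  W(F_{n,a}) + 1 = W(C_{p+2}) + W(C_{q+2}) + X(p,q),
  W(C_{n,3})     = W(C_{p+q}) + 2 (s(p+q) + p + q) + 1,

where s(m) = ⌊m²/4⌋ is the distance sum from one vertex of C_m, W(C_m) = m s(m) / 2, and
X(p,q) collects the distances between the two cycles off the shared edge. Each term has a
closed form depending only on the parities of p and q, and in each of the four cases
8 (W(C_{n,3}) - W(F_{n,a})) is a polynomial with nonnegative coefficients in ⌊(p-2)/2⌋ and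
⌊(q-2)/2⌋ that vanishes only when p = 2 or q = 2.
-}

open import Defs
open import Data.Bool using (Bool; true; false; T; T?; _∧_; _∨_; if_then_else_)
open import Data.Bool.Properties using (T-∨; T-∧)
open import Data.Bool.ListAction using (any)
open import Data.Empty using (⊥-elim)
open import Data.List using (List; map; upTo; applyUpTo; concatMap)
open import Data.List.Membership.Propositional using (find; lose)
open import Data.List.Membership.Propositional.Properties using (∈-upTo⁺; ∈-upTo⁻)
open import Data.List.Relation.Unary.Any as Any using (Any; here; there)
open import Data.List.Relation.Unary.Any.Properties using (any⁺; any⁻; ++⁻; ++⁺ˡ; ++⁺ʳ)
open import Data.Nat
open import Data.Nat.Properties
open import Data.Nat.ListAction using (sum)
open import Data.Nat.ListAction.Properties using (sum-++)
open import Data.Nat.Tactic.RingSolver using (solve-∀)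
open import Data.Product as Prod using (_×_; _,_; proj₁; proj₂; ∃-syntax)
open import Data.Sum as Sum using (_⊎_; inj₁; inj₂)
open import Data.Unit using (tt)
open import Function using (id; _∘_; Equivalence)
open import Relation.Binary.Definitions using (Tri; tri<; tri≈; tri>)
open import Relation.Binary.PropositionalEquality
open import Relation.Nullary using (¬_; yes; no)

open Equivalence using (to; from)

-- Distances from a breadth-first labelling

any-upTo⁻ : ∀ (p : ℕ → Bool) n → T (any p (upTo n)) → ∃[ z ] z < n × T (p z)
any-upTo⁻ p n h with z , z∈ , pz ← find (any⁻ p (upTo n) h) = z , ∈-upTo⁻ z∈ , pz

any-upTo⁺ : ∀ (p : ℕ → Bool) {n z} → z < n → T (p z) → T (any p (upTo n))
any-upTo⁺ p z<n pz = any⁺ p (lose {P = T ∘ p} (∈-upTo⁺ z<n) pz)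

record DistanceLabelling (G : Graph) (x : ℕ) (D : ℕ → ℕ) : Set where
  field
    root      : D x ≡ 0
    root-only : ∀ y → y < order G → D y ≡ 0 → y ≡ x
    lipschitz : ∀ z y → z < order G → y < order G → T (adj G z y) → D y ≤ suc (D z)
    parent    : ∀ y → y < order G → 0 < D y →
                ∃[ z ] z < order G × T (adj G z y) × suc (D z) ≤ D y
    bounded   : ∀ y → y < order G → D y ≤ order G

module _ {G x D} (L : DistanceLabelling G x D) where
  open DistanceLabelling L

  reach⇒≤ : ∀ k y → y < order G → T (reach G k x y) → D y ≤ k
  reach⇒≤ zero y _ h rewrite sym (≡ᵇ⇒≡ x y h) = ≤-reflexive root
  reach⇒≤ (suc k) y y< h with to T-∨ h
  ... | inj₁ r = m≤n⇒m≤1+n (reach⇒≤ k y y< r)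
  ... | inj₂ w =
    let z , z< , rz∧azy = any-upTo⁻ _ (order G) w
        rz , azy        = to T-∧ rz∧azy
    in ≤-trans (lipschitz z y z< y< azy) (s≤s (reach⇒≤ k z z< rz))

  ≤⇒reach : ∀ k y → y < order G → D y ≤ k → T (reach G k x y)
  ≤⇒reach zero y y< Dy≤0 rewrite root-only y y< (n≤0⇒n≡0 Dy≤0) = ≡⇒≡ᵇ x x refl
  ≤⇒reach (suc k) y y< Dy≤ with m≤n⇒m<n∨m≡n Dy≤
  ... | inj₁ Dy<1+k = from T-∨ (inj₁ (≤⇒reach k y y< (≤-pred Dy<1+k)))
  ... | inj₂ Dy≡1+k =
    let z , z< , azy , Dz<Dy = parent y y< (subst (0 <_) (sym Dy≡1+k) z<s)
        Dz≤k                 = ≤-pred (≤-trans Dz<Dy (≤-reflexive Dy≡1+k))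
    in from T-∨ (inj₂ (any-upTo⁺ _ z< (from T-∧ (≤⇒reach k z z< Dz≤k , azy))))

  distFrom≡ : ∀ f k y → y < order G → k ≤ D y → D y ≤ k + f → distFrom G k f x y ≡ D y
  distFrom≡ zero k y _ k≤Dy Dy≤k+0 = ≤-antisym k≤Dy (subst (D y ≤_) (+-identityʳ k) Dy≤k+0)
  distFrom≡ (suc f) k y y< k≤Dy Dy≤ with reach G k x y in r
  ... | true = ≤-antisym k≤Dy (reach⇒≤ k y y< (subst T (sym r) tt))
  ... | false with m≤n⇒m<n∨m≡n k≤Dy
  ...   | inj₁ k<Dy = distFrom≡ f (suc k) y y< k<Dy (subst (D y ≤_) (+-suc k f) Dy≤)
  ...   | inj₂ refl = ⊥-elim (subst T r (≤⇒reach k y y< ≤-refl))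

  dist≡ : ∀ y → y < order G → dist G x y ≡ D y
  dist≡ y y< = distFrom≡ (order G) 0 y y< z≤n (bounded y y<)

-- Distances on a cycle

arc : ℕ → ℕ → ℕ
arc m d = d ⊓ (m ∸ d)

cycleDist : ℕ → ℕ → ℕ → ℕ
cycleDist m i j = arc m ∣ i - j ∣

data CycleAdj (m j k : ℕ) : Set where
  forward  : suc j ≡ k → CycleAdj m j k
  backward : suc k ≡ j → CycleAdj m j k
  wrap     : suc j ≡ m → k ≡ 0 → CycleAdj m j k
  unwrap   : suc k ≡ m → j ≡ 0 → CycleAdj m j k

CycleAdj-sym : ∀ {m j k} → CycleAdj m j k → CycleAdj m k j
CycleAdj-sym (forward e)  = backward e
CycleAdj-sym (backward e) = forward e
CycleAdj-sym (wrap e e′)   = unwrap e e′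
CycleAdj-sym (unwrap e e′) = wrap e e′

m∸n≡1+m∸[1+n] : ∀ m n → suc n ≤ m → m ∸ n ≡ suc (m ∸ suc n)
m∸n≡1+m∸[1+n] (suc m) zero    _         = refl
m∸n≡1+m∸[1+n] (suc m) (suc n) (s≤s n<m) = m∸n≡1+m∸[1+n] m n n<m

m⊓n≡0⇒m≡0∨n≡0 : ∀ m n → m ⊓ n ≡ 0 → m ≡ 0 ⊎ n ≡ 0
m⊓n≡0⇒m≡0∨n≡0 zero    n    _ = inj₁ refl
m⊓n≡0⇒m≡0∨n≡0 (suc m) zero _ = inj₂ refl

arc-suc≤ : ∀ m d → arc m (suc d) ≤ suc (arc m d)
arc-suc≤ m d = ⊓-mono-≤ {suc d} {suc d} ≤-refl (≤-trans (∸-monoʳ-≤ m (n≤1+n d)) (n≤1+n _))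

arc≤1+arc-suc : ∀ m d → suc d ≤ m → arc m d ≤ suc (arc m (suc d))
arc≤1+arc-suc m d d<m =
  ⊓-mono-≤ {d} {suc (suc d)} (m≤n⇒m≤1+n (n≤1+n d)) (≤-reflexive (m∸n≡1+m∸[1+n] m d d<m))

arc-complement : ∀ m d → d ≤ m → arc m (m ∸ d) ≡ arc m d
arc-complement m d d≤m rewrite m∸[m∸n]≡n d≤m = ⊓-comm (m ∸ d) d

∣m-1+n∣≡1+∣m-n∣∨1+∣m-1+n∣≡∣m-n∣ : ∀ m n → ∣ m - suc n ∣ ≡ suc ∣ m - n ∣ ⊎ suc ∣ m - suc n ∣ ≡ ∣ m - n ∣
∣m-1+n∣≡1+∣m-n∣∨1+∣m-1+n∣≡∣m-n∣ zero    n       = inj₁ refl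
∣m-1+n∣≡1+∣m-n∣∨1+∣m-1+n∣≡∣m-n∣ (suc m) zero    = inj₂ (cong suc (∣-∣-identityʳ m))
∣m-1+n∣≡1+∣m-n∣∨1+∣m-1+n∣≡∣m-n∣ (suc m) (suc n) = ∣m-1+n∣≡1+∣m-n∣∨1+∣m-1+n∣≡∣m-n∣ m n

m≤n⇒∣m-1+n∣≡1+∣m-n∣ : ∀ m n → m ≤ n → ∣ m - suc n ∣ ≡ suc ∣ m - n ∣
m≤n⇒∣m-1+n∣≡1+∣m-n∣ zero    n       _         = refl
m≤n⇒∣m-1+n∣≡1+∣m-n∣ (suc m) (suc n) (s≤s m≤n) = m≤n⇒∣m-1+n∣≡1+∣m-n∣ m n m≤n

n<m⇒1+∣m-1+n∣≡∣m-n∣ : ∀ m n → n < m → suc ∣ m - suc n ∣ ≡ ∣ m - n ∣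
n<m⇒1+∣m-1+n∣≡∣m-n∣ (suc m) zero    _         = cong suc (∣-∣-identityʳ m)
n<m⇒1+∣m-1+n∣≡∣m-n∣ (suc m) (suc n) (s≤s n<m) = n<m⇒1+∣m-1+n∣≡∣m-n∣ m n n<m

∣m-n∣<o : ∀ {o} m n → m < o → n < o → ∣ m - n ∣ < o
∣m-n∣<o m n m<o n<o = ≤-<-trans (∣m-n∣≤m⊔n m n) (⊔-lub m<o n<o)

cycleDist-refl : ∀ m i → cycleDist m i i ≡ 0
cycleDist-refl m i rewrite ∣n-n∣≡0 i = refl

cycleDist≡0⇒≡ : ∀ m i j → i < m → j < m → cycleDist m i j ≡ 0 → i ≡ j
cycleDist≡0⇒≡ m i j i<m j<m e with m⊓n≡0⇒m≡0∨n≡0 ∣ i - j ∣ (m ∸ ∣ i - j ∣) e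
... | inj₁ ∣i-j∣≡0 = ∣m-n∣≡0⇒m≡n ∣i-j∣≡0
... | inj₂ m∸≡0    = ⊥-elim (<⇒≱ (∣m-n∣<o i j i<m j<m) (m∸n≡0⇒m≤n m∸≡0))

cycleDist< : ∀ m i j → i < m → j < m → cycleDist m i j < m
cycleDist< m i j i<m j<m = ≤-<-trans (m⊓n≤m _ _) (∣m-n∣<o i j i<m j<m)

cycleDist-lipschitz : ∀ m i j k → i < m → j < m → CycleAdj m j k →
                      cycleDist m i k ≤ suc (cycleDist m i j)
cycleDist-lipschitz m i j k i<m j<m (forward refl) with ∣m-1+n∣≡1+∣m-n∣∨1+∣m-1+n∣≡∣m-n∣ i j
... | inj₁ e rewrite e = arc-suc≤ m _
... | inj₂ e rewrite sym e = arc≤1+arc-suc m _ (<⇒≤ (subst (_< m) (sym e) (∣m-n∣<o i j i<m j<m)))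
cycleDist-lipschitz m i j k i<m j<m (backward refl) with ∣m-1+n∣≡1+∣m-n∣∨1+∣m-1+n∣≡∣m-n∣ i k
... | inj₁ e rewrite e = arc≤1+arc-suc m _ (<⇒≤ (subst (_< m) e (∣m-n∣<o i j i<m j<m)))
... | inj₂ e rewrite sym e = arc-suc≤ m _
cycleDist-lipschitz m i j k i<m j<m (wrap refl refl) = begin
  arc m ∣ i - 0 ∣        ≡⟨ cong (arc m) (∣-∣-identityʳ i) ⟩
  arc m i                ≤⟨ arc≤1+arc-suc m i i<m ⟩
  suc (arc m (suc i))    ≡⟨ cong suc (arc-complement m (suc i) i<m) ⟨
  suc (arc m (j ∸ i))    ≡⟨ cong (suc ∘ arc m) (m≤n⇒∣m-n∣≡n∸m (≤-pred i<m)) ⟨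
  suc (cycleDist m i j)  ∎
  where open ≤-Reasoning
cycleDist-lipschitz m i j k i<m j<m (unwrap refl refl) = begin
  arc m ∣ i - k ∣        ≡⟨ cong (arc m) (m≤n⇒∣m-n∣≡n∸m (≤-pred i<m)) ⟩
  arc m (k ∸ i)          ≡⟨ arc-complement m (suc i) i<m ⟩
  arc m (suc i)          ≤⟨ arc-suc≤ m i ⟩
  suc (arc m i)          ≡⟨ cong (suc ∘ arc m) (∣-∣-identityʳ i) ⟨
  suc (cycleDist m i 0)  ∎
  where open ≤-Reasoning

private
  1+arc≤ : ∀ m d → suc (arc m d) ≤ suc d
  1+arc≤ m d = s≤s (m⊓n≤m d (m ∸ d))

  1+arc-suc≤ : ∀ m d → suc d < m → suc (arc m (suc d)) ≤ m ∸ d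
  1+arc-suc≤ m d d+1<m = begin
    suc (arc m (suc d))  ≤⟨ s≤s (m⊓n≤n _ _) ⟩
    suc (m ∸ suc d)      ≡⟨ m∸n≡1+m∸[1+n] m d (<⇒≤ d+1<m) ⟨
    m ∸ d                ∎
    where open ≤-Reasoning

neighbour-closer-direct : ∀ m i j → i < m → j < m → i ≢ j → Tri (i < j) (i ≡ j) (j < i) →
  ∃[ k ] k < m × CycleAdj m k j × suc (cycleDist m i k) ≤ ∣ i - j ∣
neighbour-closer-direct m i (suc k) i<m k+1<m _ (tri< (s≤s i≤k) _ _) =
  k , <-trans (n<1+n k) k+1<m , forward refl , (begin
    suc (cycleDist m i k)  ≤⟨ 1+arc≤ m _ ⟩
    suc ∣ i - k ∣          ≡⟨ m≤n⇒∣m-1+n∣≡1+∣m-n∣ i k i≤k ⟨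
    ∣ i - suc k ∣          ∎)
  where open ≤-Reasoning
neighbour-closer-direct m i j _ _ i≢j (tri≈ _ i≡j _) = ⊥-elim (i≢j i≡j)
neighbour-closer-direct m i j i<m _ _ (tri> _ _ j<i) =
  suc j , ≤-<-trans j<i i<m , backward refl , (begin
    suc (cycleDist m i (suc j))  ≤⟨ 1+arc≤ m _ ⟩
    suc ∣ i - suc j ∣            ≡⟨ n<m⇒1+∣m-1+n∣≡∣m-n∣ i j j<i ⟩
    ∣ i - j ∣                    ∎)
  where open ≤-Reasoning

neighbour-closer-around : ∀ m i j → i < m → j < m → i ≢ j → Tri (i < j) (i ≡ j) (j < i) →
  ∃[ k ] k < m × CycleAdj m k j × suc (cycleDist m i k) ≤ m ∸ ∣ i - j ∣
neighbour-closer-around m i j i<m j<m _ (tri< i<j _ _) with m≤n⇒m<n∨m≡n j<m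
... | inj₁ j+1<m = suc j , j+1<m , backward refl , (begin
    suc (arc m ∣ i - suc j ∣)  ≡⟨ cong (suc ∘ arc m) ∣i-j-1∣ ⟩
    suc (arc m (suc ∣ i - j ∣)) ≤⟨ 1+arc-suc≤ m _ (subst (_< m) ∣i-j-1∣ (∣m-n∣<o i (suc j) i<m j+1<m)) ⟩
    m ∸ ∣ i - j ∣              ∎)
  where open ≤-Reasoning
        ∣i-j-1∣ = m≤n⇒∣m-1+n∣≡1+∣m-n∣ i j (<⇒≤ i<j)
... | inj₂ refl = 0 , z<s , unwrap refl refl , (begin
    suc (arc (suc j) ∣ i - 0 ∣)  ≡⟨ cong (suc ∘ arc (suc j)) (∣-∣-identityʳ i) ⟩
    suc (arc (suc j) i)          ≤⟨ 1+arc≤ (suc j) i ⟩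
    suc i                        ≡⟨ cong suc (m∸[m∸n]≡n (<⇒≤ i<j)) ⟨
    suc (j ∸ (j ∸ i))            ≡⟨ +-∸-assoc 1 (m∸n≤m j i) ⟨
    suc j ∸ (j ∸ i)              ≡⟨ cong (suc j ∸_) (m≤n⇒∣m-n∣≡n∸m (<⇒≤ i<j)) ⟨
    suc j ∸ ∣ i - j ∣            ∎)
  where open ≤-Reasoning
neighbour-closer-around m i j _ _ i≢j (tri≈ _ i≡j _) = ⊥-elim (i≢j i≡j)
neighbour-closer-around m i (suc k) i<m k+1<m _ (tri> _ _ k+1<i) =
  k , <-trans (n<1+n k) k+1<m , forward refl , (begin
    suc (arc m ∣ i - k ∣)        ≡⟨ cong (suc ∘ arc m) ∣i-k∣ ⟨
    suc (arc m (suc ∣ i - suc k ∣)) ≤⟨ 1+arc-suc≤ m _ (subst (_< m) (sym ∣i-k∣) (∣m-n∣<o i k i<m (<-trans (n<1+n k) k+1<m))) ⟩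
    m ∸ ∣ i - suc k ∣            ∎)
  where open ≤-Reasoning
        ∣i-k∣ = n<m⇒1+∣m-1+n∣≡∣m-n∣ i k (<-trans (n<1+n k) k+1<i)
neighbour-closer-around (suc m) i zero (s≤s i≤m) _ _ (tri> _ _ _) =
  m , n<1+n m , wrap refl refl , (begin
    suc (arc (suc m) ∣ i - m ∣)  ≡⟨ cong (suc ∘ arc (suc m)) (m≤n⇒∣m-n∣≡n∸m i≤m) ⟩
    suc (arc (suc m) (m ∸ i))    ≤⟨ 1+arc≤ (suc m) (m ∸ i) ⟩
    suc (m ∸ i)                  ≡⟨ +-∸-assoc 1 i≤m ⟨
    suc m ∸ i                    ≡⟨ cong (suc m ∸_) (∣-∣-identityʳ i) ⟨
    suc m ∸ ∣ i - 0 ∣            ∎)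
  where open ≤-Reasoning

cycleDist-parent : ∀ m i j → i < m → j < m → i ≢ j →
  ∃[ k ] k < m × CycleAdj m k j × suc (cycleDist m i k) ≤ cycleDist m i j
cycleDist-parent m i j i<m j<m i≢j with ∣ i - j ∣ ≤? m ∸ ∣ i - j ∣
... | yes direct rewrite m≤n⇒m⊓n≡m direct =
  neighbour-closer-direct m i j i<m j<m i≢j (<-cmp i j)
... | no around rewrite m≥n⇒m⊓n≡n (<⇒≤ (≰⇒> around)) =
  neighbour-closer-around m i j i<m j<m i≢j (<-cmp i j)

-- Gluing two pieces

record Piece (G : Graph) : Set where
  field
    mem         : ℕ → Bool
    δ           : ℕ → ℕ → ℕ
    size        : ℕ
    δ-refl      : ∀ u → δ u u ≡ 0
    δ≡0⇒≡       : ∀ u y → u < order G → y < order G → T (mem u) → T (mem y) → δ u y ≡ 0 → u ≡ y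
    δ-lipschitz : ∀ u z y → u < order G → z < order G → y < order G →
                  T (mem u) → T (mem z) → T (mem y) → T (adj G z y) → δ u y ≤ suc (δ u z)
    δ-parent    : ∀ u y → u < order G → y < order G → T (mem u) → T (mem y) → u ≢ y →
                  ∃[ z ] z < order G × T (mem z) × T (adj G z y) × suc (δ u z) ≤ δ u y
    δ<size      : ∀ u y → u < order G → y < order G → T (mem u) → T (mem y) → δ u y < size


open Piece using (mem; δ; size)

record CycleEmbedding (G : Graph) (m : ℕ) : Set where
  field
    onCycle       : ℕ → Bool
    pos           : ℕ → ℕ
    vertex        : ℕ → ℕ
    pos<          : ∀ v → v < order G → T (onCycle v) → pos v < m
    vertex<       : ∀ k → k < m → vertex k < order G
    vertex∈       : ∀ k → k < m → T (onCycle (vertex k))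
    pos∘vertex    : ∀ k → k < m → pos (vertex k) ≡ k
    pos-injective : ∀ u v → u < order G → v < order G → T (onCycle u) → T (onCycle v) → pos u ≡ pos v → u ≡ v
    adj⇒CycleAdj  : ∀ z y → z < order G → y < order G → T (onCycle z) → T (onCycle y) → T (adj G z y) →
                    CycleAdj m (pos z) (pos y)
    CycleAdj⇒adj  : ∀ j k → j < m → k < m → CycleAdj m j k → T (adj G (vertex j) (vertex k))

cyclePiece : ∀ {G m} → CycleEmbedding G m → Piece G
cyclePiece {G} {m} E = record
  { mem         = onCycle
  ; δ           = λ u v → cycleDist m (pos u) (pos v)
  ; size        = m
  ; δ-refl      = λ u → cycleDist-refl m (pos u)
  ; δ≡0⇒≡       = λ u y u< y< u∈ y∈ e →
      pos-injective u y u< y< u∈ y∈ (cycleDist≡0⇒≡ m _ _ (pos< u u< u∈) (pos< y y< y∈) e)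
  ; δ-lipschitz = λ u z y u< z< y< u∈ z∈ y∈ a →
      cycleDist-lipschitz m _ _ _ (pos< u u< u∈) (pos< z z< z∈) (adj⇒CycleAdj z y z< y< z∈ y∈ a)
  ; δ-parent    = parent
  ; δ<size      = λ u y u< y< u∈ y∈ → cycleDist< m _ _ (pos< u u< u∈) (pos< y y< y∈)
  }
  where
  open CycleEmbedding E
  parent : ∀ u y → u < order G → y < order G → T (onCycle u) → T (onCycle y) → u ≢ y →
           ∃[ z ] z < order G × T (onCycle z) × T (adj G z y) ×
                  suc (cycleDist m (pos u) (pos z)) ≤ cycleDist m (pos u) (pos y)
  parent u y u< y< u∈ y∈ u≢y =
    let py<m = pos< y y< y∈
        k , k<m , k~py , closer = cycleDist-parent m (pos u) (pos y) (pos< u u< u∈) py<m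
                                    (u≢y ∘ pos-injective u y u< y< u∈ y∈)
        vertex∘pos = pos-injective _ y (vertex< _ py<m) y< (vertex∈ _ py<m) y∈ (pos∘vertex _ py<m)
    in vertex k , vertex< k k<m , vertex∈ k k<m ,
       subst (λ w → T (adj G (vertex k) w)) vertex∘pos (CycleAdj⇒adj k (pos y) k<m py<m k~py) ,
       subst (λ w → suc (cycleDist m (pos u) w) ≤ cycleDist m (pos u) (pos y)) (sym (pos∘vertex k k<m)) closer

Portal : ℕ → ℕ → ℕ → Set
Portal s₀ s₁ s = s ≡ s₀ ⊎ s ≡ s₁

record Gluing (G : Graph) : Set where
  field
    P Q         : Piece G
    s₀ s₁       : ℕ
    portal-in   : ∀ s → Portal s₀ s₁ s → s < order G × T (mem P s) × T (mem Q s)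
    portals-adj : s₀ ≢ s₁ → T (adj G s₀ s₁) × T (adj G s₁ s₀)
    cover       : ∀ v → v < order G → T (mem P v) ⊎ T (mem Q v)
    meet        : ∀ v → v < order G → T (mem P v) → T (mem Q v) → Portal s₀ s₁ v
    local       : ∀ z y → z < order G → y < order G → T (adj G z y) →
                  T (mem P z) × T (mem P y) ⊎ T (mem Q z) × T (mem Q y)
    -- The size bounds keep every candidate distance within the search bound order G of dist.
    P-size      : size P ≤ suc (order G)
    Q-size      : size Q ≤ suc (order G)
    sizes       : size P + size Q ≤ 2 + order G

swap : ∀ {G} → Gluing G → Gluing G
swap {G} Γ = record
  { P           = Q
  ; Q           = P
  ; s₀          = s₀
  ; s₁          = s₁
  ; portal-in   = λ s ps → let s< , s∈P , s∈Q = portal-in s ps in s< , s∈Q , s∈P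
  ; portals-adj = portals-adj
  ; cover       = λ v v< → Sum.swap (cover v v<)
  ; meet        = λ v v< v∈Q v∈P → meet v v< v∈P v∈Q
  ; local       = λ z y z< y< a → Sum.swap (local z y z< y< a)
  ; P-size      = Q-size
  ; Q-size      = P-size
  ; sizes       = subst (λ s → s ≤ 2 + order G) (+-comm (size P) (size Q)) sizes
  }
  where open Gluing Γ

module GluedDistance {G : Graph} (Γ : Gluing G) (x : ℕ) (x< : x < order G)
                     (x∈P : T (mem (Gluing.P Γ) x)) where
  open Gluing Γ
  open Piece using (δ-refl; δ≡0⇒≡; δ-lipschitz; δ-parent; δ<size)

  -- A shortest path from x to a vertex outside P leaves P through one of the portals.
  crossing : ℕ → ℕ
  crossing y = (δ P x s₀ + δ Q s₀ y) ⊓ (δ P x s₁ + δ Q s₁ y)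

  profile : ℕ → ℕ
  profile y = if mem P y then δ P x y else crossing y

  private
    n = order G

    profile-in : ∀ y → T (mem P y) → profile y ≡ δ P x y
    profile-in y y∈ with mem P y
    ... | true = refl

    profile-out : ∀ y → ¬ T (mem P y) → profile y ≡ crossing y
    profile-out y y∉ with mem P y
    ... | true  = ⊥-elim (y∉ tt)
    ... | false = refl

    outside⇒Q : ∀ y → y < n → ¬ T (mem P y) → T (mem Q y)
    outside⇒Q y y< y∉ = Sum.[ ⊥-elim ∘ y∉ , id ]′ (cover y y<)

    edge-in-Q : ∀ z y → z < n → y < n → T (adj G z y) → ¬ T (mem P z) ⊎ ¬ T (mem P y) →
                T (mem Q z) × T (mem Q y)
    edge-in-Q z y z< y< a out with local z y z< y< a
    ... | inj₁ (z∈ , y∈) = ⊥-elim (Sum.[ (λ z∉ → z∉ z∈) , (λ y∉ → y∉ y∈) ]′ out)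
    ... | inj₂ zy∈Q      = zy∈Q

    portal-adj : ∀ s t → Portal s₀ s₁ s → Portal s₀ s₁ t → s ≢ t → T (adj G s t)
    portal-adj s t (inj₁ refl) (inj₁ refl) s≢t = ⊥-elim (s≢t refl)
    portal-adj s t (inj₁ refl) (inj₂ refl) s≢t = proj₁ (portals-adj s≢t)
    portal-adj s t (inj₂ refl) (inj₁ refl) s≢t = proj₂ (portals-adj (s≢t ∘ sym))
    portal-adj s t (inj₂ refl) (inj₂ refl) s≢t = ⊥-elim (s≢t refl)

    via-portal : ∀ s t → Portal s₀ s₁ s → Portal s₀ s₁ t → δ P x t ≤ δ P x s + δ Q s t
    via-portal s t ps pt with s ≟ t
    ... | yes refl = m≤m+n _ _
    ... | no s≢t =
      let s< , s∈P , s∈Q = portal-in s ps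
          t< , t∈P , t∈Q = portal-in t pt
          δQst≢0 = s≢t ∘ δ≡0⇒≡ Q s t s< t< s∈Q t∈Q
      in ≤-trans (δ-lipschitz P x s t x< s< t< x∈P s∈P t∈P (portal-adj s t ps pt s≢t))
                 (subst (_≤ δ P x s + δ Q s t) (+-comm (δ P x s) 1)
                   (+-monoʳ-≤ (δ P x s) (n≢0⇒n>0 δQst≢0)))

    crossing≤ : ∀ s y → Portal s₀ s₁ s → crossing y ≤ δ P x s + δ Q s y
    crossing≤ s y (inj₁ refl) = m⊓n≤m _ _
    crossing≤ s y (inj₂ refl) = m⊓n≤n _ _

    crossing-attained : ∀ y → ∃[ s ] Portal s₀ s₁ s × crossing y ≡ δ P x s + δ Q s y
    crossing-attained y with ⊓-sel (δ P x s₀ + δ Q s₀ y) (δ P x s₁ + δ Q s₁ y)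
    ... | inj₁ e = s₀ , inj₁ refl , e
    ... | inj₂ e = s₁ , inj₂ refl , e

    profile≤via : ∀ s z → Portal s₀ s₁ s → z < n → T (mem Q z) → profile z ≤ δ P x s + δ Q s z
    profile≤via s z ps z< z∈Q with T? (mem P z)
    ... | yes z∈P rewrite profile-in z z∈P = via-portal s z ps (meet z z< z∈P z∈Q)
    ... | no z∉P rewrite profile-out z z∉P = crossing≤ s z ps

    Q-step : ∀ s z y → Portal s₀ s₁ s → z < n → y < n → T (mem Q z) → T (mem Q y) →
             T (adj G z y) → δ P x s + δ Q s y ≤ suc (δ P x s + δ Q s z)
    Q-step s z y ps z< y< z∈Q y∈Q a =
      let s< , _ , s∈Q = portal-in s ps
      in subst (δ P x s + δ Q s y ≤_) (+-suc (δ P x s) (δ Q s z))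
           (+-monoʳ-≤ (δ P x s) (δ-lipschitz Q s z y s< z< y< s∈Q z∈Q y∈Q a))

    root-only : ∀ y → y < n → profile y ≡ 0 → y ≡ x
    root-only y y< e with T? (mem P y)
    ... | yes y∈P = sym (δ≡0⇒≡ P x y x< y< x∈P y∈P (trans (sym (profile-in y y∈P)) e))
    ... | no y∉P =
      let s , ps , cs    = crossing-attained y
          s< , s∈P , s∈Q = portal-in s ps
          δQsy≡0 = m+n≡0⇒n≡0 (δ P x s) (trans (sym cs) (trans (sym (profile-out y y∉P)) e))
          s≡y    = δ≡0⇒≡ Q s y s< y< s∈Q (outside⇒Q y y< y∉P) δQsy≡0
      in ⊥-elim (y∉P (subst (T ∘ mem P) s≡y s∈P))

    lipschitz : ∀ z y → z < n → y < n → T (adj G z y) → profile y ≤ suc (profile z)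
    lipschitz z y z< y< a with T? (mem P z) | T? (mem P y)
    ... | yes z∈P | yes y∈P rewrite profile-in z z∈P | profile-in y y∈P =
      δ-lipschitz P x z y x< z< y< x∈P z∈P y∈P a
    ... | no z∉P | no y∉P rewrite profile-out z z∉P | profile-out y y∉P =
      ⊓-mono-≤ (Q-step s₀ z y (inj₁ refl) z< y< z∈Q y∈Q a) (Q-step s₁ z y (inj₂ refl) z< y< z∈Q y∈Q a)
      where z∈Q = outside⇒Q z z< z∉P
            y∈Q = outside⇒Q y y< y∉P
    ... | yes z∈P | no y∉P rewrite profile-in z z∈P | profile-out y y∉P =
      let z∈Q , y∈Q = edge-in-Q z y z< y< a (inj₂ y∉P)
          pz = meet z z< z∈P z∈Q
      in ≤-trans (crossing≤ z y pz)
           (≤-trans (+-monoʳ-≤ (δ P x z) (δ-lipschitz Q z z y z< z< y< z∈Q z∈Q y∈Q a))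
             (≤-reflexive (trans (cong (λ w → δ P x z + suc w) (δ-refl Q z)) (+-comm (δ P x z) 1))))
    ... | no z∉P | yes y∈P rewrite profile-out z z∉P | profile-in y y∈P =
      let z∈Q , y∈Q = edge-in-Q z y z< y< a (inj₁ z∉P)
          py = meet y y< y∈P y∈Q
          bound : ∀ s → Portal s₀ s₁ s → δ P x y ≤ suc (δ P x s + δ Q s z)
          bound s ps = ≤-trans (via-portal s y ps py) (Q-step s z y ps z< y< z∈Q y∈Q a)
      in ⊓-glb (bound s₀ (inj₁ refl)) (bound s₁ (inj₂ refl))

    parent : ∀ y → y < n → 0 < profile y → ∃[ z ] z < n × T (adj G z y) × suc (profile z) ≤ profile y
    parent y y< pos with T? (mem P y)
    ... | yes y∈P rewrite profile-in y y∈P =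
      let x≢y = λ x≡y → <⇒≢ pos (sym (trans (cong (δ P x) (sym x≡y)) (δ-refl P x)))
          z , z< , z∈P , a , closer = δ-parent P x y x< y< x∈P y∈P x≢y
      in z , z< , a , subst (λ w → suc w ≤ δ P x y) (sym (profile-in z z∈P)) closer
    ... | no y∉P rewrite profile-out y y∉P =
      let s , ps , cs    = crossing-attained y
          s< , s∈P , s∈Q = portal-in s ps
          s≢y = λ s≡y → y∉P (subst (T ∘ mem P) s≡y s∈P)
          z , z< , z∈Q , a , closer = δ-parent Q s y s< y< s∈Q (outside⇒Q y y< y∉P) s≢y
      in z , z< , a ,
         ≤-trans (s≤s (profile≤via s z ps z< z∈Q))
           (subst (_≤ crossing y) (+-suc (δ P x s) (δ Q s z))
             (subst (δ P x s + suc (δ Q s z) ≤_) (sym cs) (+-monoʳ-≤ (δ P x s) closer)))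

    bounded : ∀ y → y < n → profile y ≤ n
    bounded y y< with T? (mem P y)
    ... | yes y∈P rewrite profile-in y y∈P = ≤-pred (≤-trans (δ<size P x y x< y< x∈P y∈P) P-size)
    ... | no y∉P rewrite profile-out y y∉P =
      let s< , s∈P , s∈Q = portal-in s₀ (inj₁ refl)
          two+ : 2 + (δ P x s₀ + δ Q s₀ y) ≤ size P + size Q
          two+ = subst (_≤ size P + size Q) (cong suc (+-suc (δ P x s₀) (δ Q s₀ y)))
                   (+-mono-≤ (δ<size P x s₀ x< s< x∈P s∈P)
                             (δ<size Q s₀ y s< y< s∈Q (outside⇒Q y y< y∉P)))
      in ≤-trans (crossing≤ s₀ y (inj₁ refl)) (+-cancelˡ-≤ 2 _ _ (≤-trans two+ sizes))

  labelling : DistanceLabelling G x profile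
  labelling = record
    { root      = trans (profile-in x x∈P) (δ-refl P x)
    ; root-only = root-only
    ; lipschitz = lipschitz
    ; parent    = parent
    ; bounded   = bounded
    }

  dist-inside : ∀ y → y < n → T (mem P y) → dist G x y ≡ δ P x y
  dist-inside y y< y∈P = trans (dist≡ labelling y y<) (profile-in y y∈P)

  dist-across : ∀ y → y < n → ¬ T (mem P y) → dist G x y ≡ crossing y
  dist-across y y< y∉P = trans (dist≡ labelling y y<) (profile-out y y∉P)

-- The graphs F_{n,a} and C_{n,3}

Joins : ℕ → ℕ → ℕ × ℕ → Set
Joins x y (p , q) = (p ≡ x × q ≡ y) ⊎ (p ≡ y × q ≡ x)

module _ (G : Graph) where

  adj⇒Any : ∀ {x y} → T (adj G x y) → Any (Joins x y) (edges G)
  adj⇒Any {x} {y} h = Any.map (λ {(p , q)} → Sum.map (ends p x q y) (ends p y q x) ∘ to T-∨)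
                              (any⁻ _ (edges G) h)
    where
    ends : ∀ a b c d → T ((a ≡ᵇ b) ∧ (c ≡ᵇ d)) → a ≡ b × c ≡ d
    ends a b c d h = let a≡b , c≡d = to T-∧ h in ≡ᵇ⇒≡ a b a≡b , ≡ᵇ⇒≡ c d c≡d

  Any⇒adj : ∀ {x y} → Any (Joins x y) (edges G) → T (adj G x y)
  Any⇒adj {x} {y} h = any⁺ _ (Any.map (λ {(p , q)} → from T-∨ ∘ Sum.map (ends p x q y) (ends p y q x)) h)
    where
    ends : ∀ a b c d → a ≡ b × c ≡ d → T ((a ≡ᵇ b) ∧ (c ≡ᵇ d))
    ends a b c d (a≡b , c≡d) = from T-∧ (≡⇒≡ᵇ a b a≡b , ≡⇒≡ᵇ c d c≡d)

  adj-sym : ∀ {x y} → T (adj G x y) → T (adj G y x)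
  adj-sym = Any⇒adj ∘ Any.map (λ {(p , q)} → Sum.swap) ∘ adj⇒Any

PathStep : ℕ → ℕ → ℕ → ℕ → Set
PathStep s m x y = s ≤ x × x < s + m × y ≡ suc x

pathEdges⇒PathStep : ∀ s m {x y} → Any (Joins x y) (pathEdges s m) → PathStep s m x y ⊎ PathStep s m y x
pathEdges⇒PathStep s (suc m) (here (inj₁ (refl , refl))) = inj₁ (≤-refl , s<s+1+m , refl)
  where s<s+1+m = subst (s <_) (sym (+-suc s m)) (s≤s (m≤m+n s m))
pathEdges⇒PathStep s (suc m) (here (inj₂ (refl , refl))) = inj₂ (≤-refl , s<s+1+m , refl)
  where s<s+1+m = subst (s <_) (sym (+-suc s m)) (s≤s (m≤m+n s m))
pathEdges⇒PathStep s (suc m) (there h) =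
  Sum.map widen widen (pathEdges⇒PathStep (suc s) m h)
  where
  widen : ∀ {x y} → PathStep (suc s) m x y → PathStep s (suc m) x y
  widen {x} (s<x , x< , y≡) = <⇒≤ s<x , subst (x <_) (sym (+-suc s m)) x< , y≡

PathStep⇒pathEdges : ∀ s m x → s ≤ x → x < s + m → Any (Joins x (suc x)) (pathEdges s m)
PathStep⇒pathEdges s zero x s≤x x<s+0 = ⊥-elim (<⇒≱ x<s+0 (subst (_≤ x) (sym (+-identityʳ s)) s≤x))
PathStep⇒pathEdges s (suc m) x s≤x x< with m≤n⇒m<n∨m≡n s≤x
... | inj₂ refl = here (inj₁ (refl , refl))
... | inj₁ s<x  = there (PathStep⇒pathEdges (suc s) m x s<x (subst (x <_) (+-suc s m) x<))

module FGraph (p q : ℕ) (1≤p : 1 ≤ p) (1≤q : 1 ≤ q) where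
  a n : ℕ
  a = 2 + p
  n = a + q

  G : Graph
  G = F n a

  private
    -- The length n ∸ 1 ∸ a of the path a, a+1, …, n-1 in the definition of F, as it normalises.
    K : ℕ
    K = p + q ∸ suc p

    1+pred : suc (pred q) ≡ q
    1+pred = suc-pred q {{>-nonZero 1≤q}}

    K≡pred-q : K ≡ pred q
    K≡pred-q = trans (sym (pred[m∸n]≡m∸[1+n] (p + q) p)) (cong pred (m+n∸m≡n p q))

    n≡1+a+K : n ≡ suc (a + K)
    n≡1+a+K = trans (cong (a +_) (sym 1+pred)) (trans (+-suc a (pred q)) (cong (suc ∘ (a +_)) (sym K≡pred-q)))

    along-B-bound : ∀ {w} → w < a + K → suc w < n
    along-B-bound {w} w< = subst (suc w <_) (sym n≡1+a+K) (s≤s w<)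

    p<p+q : suc p ≤ p + q
    p<p+q = subst (_≤ p + q) (+-comm p 1) (+-monoʳ-≤ p 1≤q)

  data FEdge (z y : ℕ) : Set where
    along-A  : z < suc p → y ≡ suc z → FEdge z y
    close-A  : z ≡ suc p → y ≡ 0 → FEdge z y
    junction : z ≡ 1 → y ≡ a → FEdge z y
    along-B  : a ≤ z → suc z < n → y ≡ suc z → FEdge z y
    close-B  : z ≡ suc (p + q) → y ≡ 0 → FEdge z y

  adj⇒FEdge : ∀ {z y} → T (adj G z y) → FEdge z y ⊎ FEdge y z
  adj⇒FEdge h with ++⁻ (pathEdges 0 (suc p)) (adj⇒Any G h)
  ... | inj₁ h₁ with pathEdges⇒PathStep 0 (suc p) h₁
  ...   | inj₁ (_ , z< , y≡) = inj₁ (along-A z< y≡)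
  ...   | inj₂ (_ , y< , z≡) = inj₂ (along-A y< z≡)
  adj⇒FEdge h | inj₂ (here (inj₁ (refl , refl)))         = inj₁ (close-A refl refl)
  adj⇒FEdge h | inj₂ (here (inj₂ (refl , refl)))         = inj₂ (close-A refl refl)
  adj⇒FEdge h | inj₂ (there (here (inj₁ (refl , refl)))) = inj₁ (junction refl refl)
  adj⇒FEdge h | inj₂ (there (here (inj₂ (refl , refl)))) = inj₂ (junction refl refl)
  adj⇒FEdge h | inj₂ (there (there h₂)) with ++⁻ (pathEdges a K) h₂
  ... | inj₂ (here (inj₁ (refl , refl))) = inj₁ (close-B refl refl)
  ... | inj₂ (here (inj₂ (refl , refl))) = inj₂ (close-B refl refl)
  ... | inj₁ h₃ with pathEdges⇒PathStep a K h₃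
  ...   | inj₁ (a≤z , z< , y≡) = inj₁ (along-B a≤z (along-B-bound z<) y≡)
  ...   | inj₂ (a≤y , y< , z≡) = inj₂ (along-B a≤y (along-B-bound y<) z≡)

  FEdge⇒adj : ∀ {z y} → FEdge z y → T (adj G z y)
  FEdge⇒adj (along-A z< refl) =
    Any⇒adj G (++⁺ˡ (PathStep⇒pathEdges 0 (suc p) _ z≤n z<))
  FEdge⇒adj (close-A refl refl) =
    Any⇒adj G (++⁺ʳ (pathEdges 0 (suc p)) (here (inj₁ (refl , refl))))
  FEdge⇒adj (junction refl refl) =
    Any⇒adj G (++⁺ʳ (pathEdges 0 (suc p)) (there (here (inj₁ (refl , refl)))))
  FEdge⇒adj {z} (along-B a≤z z+1<n refl) =
    Any⇒adj G (++⁺ʳ (pathEdges 0 (suc p)) (there (there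
      (++⁺ˡ (PathStep⇒pathEdges a K z a≤z (≤-pred (subst (suc z <_) n≡1+a+K z+1<n)))))))
  FEdge⇒adj (close-B refl refl) =
    Any⇒adj G (++⁺ʳ (pathEdges 0 (suc p)) (there (there (++⁺ʳ (pathEdges a K) (here (inj₁ (refl , refl)))))))

  inA inB : ℕ → Bool
  inA v = v <ᵇ a
  inB v = (v <ᵇ 2) ∨ (suc p <ᵇ v)

  data InB : ℕ → Set where
    portal₀ : InB 0
    portal₁ : InB 1
    beyond  : ∀ w → p ≤ w → InB (2 + w)

  inB⇒InB : ∀ v → T (inB v) → InB v
  inB⇒InB 0             _ = portal₀
  inB⇒InB 1             _ = portal₁
  inB⇒InB (suc (suc w)) h = beyond w (≤-pred (<ᵇ⇒< p (suc w) h))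

  a≤⇒inB : ∀ v → a ≤ v → T (inB v)
  a≤⇒inB (suc (suc w)) (s≤s (s≤s p≤w)) = <⇒<ᵇ (s≤s p≤w)

  L : ℕ
  L = 2 + q

  -- The second cycle 0, 1, a, a+1, …, n-1 is numbered so that positions 0 and 1 are the shared edge.
  posB vertexB : ℕ → ℕ
  posB (suc (suc w)) = 2 + (w ∸ p)
  posB v             = v
  vertexB (suc (suc t)) = a + t
  vertexB k             = k

  posB-beyond< : ∀ w → p ≤ w → 2 + w < n → w ∸ p < q
  posB-beyond< w p≤w w<n = subst (w ∸ p <_) (m+n∸m≡n p q) (∸-monoˡ-< (≤-pred (≤-pred w<n)) p≤w)

  A-edge : ∀ {z y} → T (inA z) → T (inA y) → FEdge z y → CycleAdj a z y
  A-edge _   _   (along-A _ refl)     = forward refl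
  A-edge _   _   (close-A refl refl)  = wrap refl refl
  A-edge _   y∈A (junction refl refl) = ⊥-elim (<-irrefl refl (<ᵇ⇒< a a y∈A))
  A-edge z∈A _   (along-B a≤z _ _)    = ⊥-elim (<⇒≱ (<ᵇ⇒< _ a z∈A) a≤z)
  A-edge z∈A _   (close-B refl refl)  = ⊥-elim (<⇒≱ (<ᵇ⇒< _ a z∈A) (s≤s p<p+q))

  CycleAdj⇒adj-A : ∀ j k → j < a → k < a → CycleAdj a j k → T (adj G j k)
  CycleAdj⇒adj-A j k _ k<a (forward e) = FEdge⇒adj (along-A (≤-pred (subst (_< a) (sym e) k<a)) (sym e))
  CycleAdj⇒adj-A j k j<a _ (backward e) =
    adj-sym G (FEdge⇒adj (along-A (≤-pred (subst (_< a) (sym e) j<a)) (sym e)))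
  CycleAdj⇒adj-A j k _ _ (wrap e e′)   = FEdge⇒adj (close-A (suc-injective e) e′)
  CycleAdj⇒adj-A j k _ _ (unwrap e e′) = adj-sym G (FEdge⇒adj (close-A (suc-injective e) e′))

  cycleA : CycleEmbedding G a
  cycleA = record
    { onCycle       = inA
    ; pos           = id
    ; vertex        = id
    ; pos<          = λ v _ v∈ → <ᵇ⇒< v a v∈
    ; vertex<       = λ k k<a → ≤-trans k<a (m≤m+n a q)
    ; vertex∈       = λ k k<a → <⇒<ᵇ k<a
    ; pos∘vertex    = λ _ _ → refl
    ; pos-injective = λ _ _ _ _ _ _ e → e
    ; adj⇒CycleAdj  = λ z y _ _ z∈ y∈ h →
        Sum.[ A-edge z∈ y∈ , CycleAdj-sym ∘ A-edge y∈ z∈ ]′ (adj⇒FEdge h)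
    ; CycleAdj⇒adj  = CycleAdj⇒adj-A
    }

  posB-a+ : ∀ t → posB (a + t) ≡ 2 + t
  posB-a+ t = cong (2 +_) (m+n∸m≡n p t)

  private
    a+pred-q≡ : a + pred q ≡ suc (p + q)
    a+pred-q≡ = cong suc (trans (sym (+-suc p (pred q))) (cong (p +_) 1+pred))

    posB-last : posB (suc (p + q)) ≡ suc q
    posB-last = trans (cong posB (sym a+pred-q≡)) (trans (posB-a+ (pred q)) (cong suc 1+pred))

    posB-injective : ∀ {u v} → InB u → InB v → posB u ≡ posB v → u ≡ v
    posB-injective portal₀ portal₀ _ = refl
    posB-injective portal₁ portal₁ _ = refl
    posB-injective (beyond w p≤w) (beyond w′ p≤w′) e =
      cong (2 +_) (trans (sym (m∸n+n≡m p≤w)) (trans (cong (_+ p) (suc-injective (suc-injective e))) (m∸n+n≡m p≤w′)))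

    B-edge : ∀ {z y} → T (inB z) → T (inB y) → FEdge z y → CycleAdj L (posB z) (posB y)
    B-edge {z} {y} z∈ y∈ e = go e (inB⇒InB z z∈)
      where
      go : FEdge z y → InB z → CycleAdj L (posB z) (posB y)
      go (along-A _ refl)     portal₀        = forward refl
      go (along-A _ refl)     portal₁        = ⊥-elim (<⇒≱ (<ᵇ⇒< p 1 y∈) 1≤p)
      go (along-A z<1+p _)    (beyond w p≤w) = ⊥-elim (<⇒≱ z<1+p (s≤s (m≤n⇒m≤1+n p≤w)))
      go (close-A refl _)     portal₁        = ⊥-elim (<⇒≱ z<s 1≤p)
      go (close-A refl _)     (beyond w p≤w) = ⊥-elim (<⇒≱ (s≤s ≤-refl) p≤w)
      go (junction refl refl) _              = forward (cong (2 +_) (sym (n∸n≡0 p)))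
      go (along-B () _ _)     portal₀
      go (along-B (s≤s ()) _ _) portal₁
      go (along-B _ _ refl)   (beyond w p≤w) = forward (cong (2 +_) (sym (+-∸-assoc 1 p≤w)))
      go (close-B refl refl)  _              = wrap (cong suc posB-last) refl

    forward-B : ∀ j → suc j < L → T (adj G (vertexB j) (vertexB (suc j)))
    forward-B 0             _     = FEdge⇒adj (along-A z<s refl)
    forward-B 1             _     = FEdge⇒adj (junction refl (+-identityʳ a))
    forward-B (suc (suc t)) j+1<L =
      FEdge⇒adj (along-B (m≤m+n a t)
                         (subst (_< n) (+-suc a t) (+-monoʳ-< a (≤-pred (≤-pred j+1<L))))
                         (+-suc a t))

    closing-B : T (adj G (vertexB (suc q)) 0)
    closing-B = subst (λ j → T (adj G (vertexB (suc j)) 0)) 1+pred (FEdge⇒adj (close-B a+pred-q≡ refl))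

    CycleAdj⇒adj-B : ∀ j k → j < L → k < L → CycleAdj L j k → T (adj G (vertexB j) (vertexB k))
    CycleAdj⇒adj-B j k _ k<L (forward refl) = forward-B j k<L
    CycleAdj⇒adj-B j k j<L _ (backward refl) = adj-sym G (forward-B k j<L)
    CycleAdj⇒adj-B j k _ _ (wrap refl refl) = closing-B
    CycleAdj⇒adj-B j k _ _ (unwrap refl refl) = adj-sym G closing-B

  cycleB : CycleEmbedding G L
  cycleB = record
    { onCycle       = inB
    ; pos           = posB
    ; vertex        = vertexB
    ; pos<          = pos<
    ; vertex<       = vertex<
    ; vertex∈       = vertex∈
    ; pos∘vertex    = pos∘vertex
    ; pos-injective = λ u v _ _ u∈ v∈ → posB-injective (inB⇒InB u u∈) (inB⇒InB v v∈)
    ; adj⇒CycleAdj  = λ z y _ _ z∈ y∈ h →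
        Sum.[ B-edge z∈ y∈ , CycleAdj-sym ∘ B-edge y∈ z∈ ]′ (adj⇒FEdge h)
    ; CycleAdj⇒adj  = CycleAdj⇒adj-B
    }
    where
    pos< : ∀ v → v < n → T (inB v) → posB v < L
    pos< v v<n v∈ with inB⇒InB v v∈
    ... | portal₀      = z<s
    ... | portal₁      = s≤s z<s
    ... | beyond w p≤w = s≤s (s≤s (posB-beyond< w p≤w v<n))
    vertex< : ∀ k → k < L → vertexB k < n
    vertex< 0             _   = z<s
    vertex< 1             _   = s≤s z<s
    vertex< (suc (suc t)) k<L = +-monoʳ-< a (≤-pred (≤-pred k<L))
    vertex∈ : ∀ k → k < L → T (inB (vertexB k))
    vertex∈ 0             _ = tt
    vertex∈ 1             _ = tt
    vertex∈ (suc (suc t)) _ = a≤⇒inB (a + t) (m≤m+n a t)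
    pos∘vertex : ∀ k → k < L → posB (vertexB k) ≡ k
    pos∘vertex 0             _ = refl
    pos∘vertex 1             _ = refl
    pos∘vertex (suc (suc t)) _ = posB-a+ t

  private
    edge₀₁ : T (adj G 0 1)
    edge₀₁ = FEdge⇒adj (along-A z<s refl)

    local-edge : ∀ {z y} → FEdge z y → T (inA z) × T (inA y) ⊎ T (inB z) × T (inB y)
    local-edge (along-A z<1+p refl) = inj₁ (<⇒<ᵇ (m<n⇒m<1+n z<1+p) , <⇒<ᵇ (s≤s z<1+p))
    local-edge (close-A refl refl)  = inj₁ (<⇒<ᵇ (n<1+n (suc p)) , tt)
    local-edge (junction refl refl) = inj₂ (tt , a≤⇒inB a ≤-refl)
    local-edge (along-B a≤z _ refl) = inj₂ (a≤⇒inB _ a≤z , a≤⇒inB _ (m≤n⇒m≤1+n a≤z))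
    local-edge (close-B refl refl)  = inj₂ (a≤⇒inB _ (s≤s p<p+q) , tt)

    meet : ∀ v → T (inA v) → T (inB v) → Portal 0 1 v
    meet v v∈A v∈B with inB⇒InB v v∈B
    ... | portal₀      = inj₁ refl
    ... | portal₁      = inj₂ refl
    ... | beyond w p≤w = ⊥-elim (<⇒≱ (<ᵇ⇒< _ a v∈A) (s≤s (s≤s p≤w)))

    cover : ∀ v → T (inA v) ⊎ T (inB v)
    cover v with v <? a
    ... | yes v<a = inj₁ (<⇒<ᵇ v<a)
    ... | no  v≮a = inj₂ (a≤⇒inB v (≮⇒≥ v≮a))

  glue : Gluing G
  glue = record
    { P           = cyclePiece cycleA
    ; Q           = cyclePiece cycleB
    ; s₀          = 0
    ; s₁          = 1
    ; portal-in   = λ { _ (inj₁ refl) → z<s , tt , tt ; _ (inj₂ refl) → s≤s z<s , tt , tt }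
    ; portals-adj = λ _ → edge₀₁ , adj-sym G {0} {1} edge₀₁
    ; cover       = λ v _ → cover v
    ; meet        = λ v _ → meet v
    ; local       = λ z y _ _ h → Sum.[ local-edge , Sum.map Prod.swap Prod.swap ∘ local-edge ]′ (adj⇒FEdge h)
    ; P-size      = ≤-trans (m≤m+n a q) (n≤1+n n)
    ; Q-size      = s≤s (s≤s (≤-trans (m≤n+m q p) (n≤1+n _)))
    ; sizes       = ≤-reflexive (trans (+-suc a (suc q)) (cong suc (+-suc a q)))
    }

  private
    a≤n : a ≤ n
    a≤n = m≤m+n a q

  dist-A : ∀ x y → x < a → y < a → dist G x y ≡ cycleDist a x y
  dist-A x y x<a y<a =
    GluedDistance.dist-inside glue x (≤-trans x<a a≤n) (<⇒<ᵇ x<a) y (≤-trans y<a a≤n) (<⇒<ᵇ y<a)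

  dist-B : ∀ x y → x < n → y < n → T (inB x) → T (inB y) → dist G x y ≡ cycleDist L (posB x) (posB y)
  dist-B x y x<n y<n x∈B y∈B = GluedDistance.dist-inside (swap glue) x x<n x∈B y y<n y∈B

  dist-across : ∀ i t → i < p → t < q →
    dist G (2 + i) (a + t) ≡ (arc a (2 + i) + arc L (2 + t)) ⊓ (arc a (1 + i) + arc L (1 + t))
  dist-across i t i<p t<q =
    trans (GluedDistance.dist-across glue (2 + i) (≤-trans x<a a≤n) (<⇒<ᵇ x<a) (a + t) (+-monoʳ-< a t<q) y∉A)
          (cong (λ y → (arc a (2 + i) + cycleDist L 0 y) ⊓ (arc a (1 + i) + cycleDist L 1 y)) (posB-a+ t))
    where
    x<a = s≤s (s≤s i<p)
    y∉A = λ y∈A → <⇒≱ (<ᵇ⇒< (a + t) a y∈A) (m≤m+n a t)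

module C3Graph (k : ℕ) (1≤k : 1 ≤ k) where
  n m : ℕ
  n = 3 + k
  m = suc k

  G : Graph
  G = C3 n

  data CEdge (z y : ℕ) : Set where
    along : z < k → y ≡ suc z → CEdge z y
    close : z ≡ k → y ≡ 0 → CEdge z y
    tri₀₁ : z ≡ 0 → y ≡ suc k → CEdge z y
    tri₁₂ : z ≡ suc k → y ≡ suc (suc k) → CEdge z y
    tri₂₀ : z ≡ suc (suc k) → y ≡ 0 → CEdge z y

  adj⇒CEdge : ∀ {z y} → T (adj G z y) → CEdge z y ⊎ CEdge y z
  adj⇒CEdge h with ++⁻ (pathEdges 0 k) (adj⇒Any G h)
  ... | inj₁ h₁ with pathEdges⇒PathStep 0 k h₁
  ...   | inj₁ (_ , z< , y≡) = inj₁ (along z< y≡)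
  ...   | inj₂ (_ , y< , z≡) = inj₂ (along y< z≡)
  adj⇒CEdge h | inj₂ (here (inj₁ (refl , refl)))                         = inj₁ (close refl refl)
  adj⇒CEdge h | inj₂ (here (inj₂ (refl , refl)))                         = inj₂ (close refl refl)
  adj⇒CEdge h | inj₂ (there (here (inj₁ (refl , refl))))                 = inj₁ (tri₀₁ refl refl)
  adj⇒CEdge h | inj₂ (there (here (inj₂ (refl , refl))))                 = inj₂ (tri₀₁ refl refl)
  adj⇒CEdge h | inj₂ (there (there (here (inj₁ (refl , refl)))))         = inj₁ (tri₁₂ refl refl)
  adj⇒CEdge h | inj₂ (there (there (here (inj₂ (refl , refl)))))         = inj₂ (tri₁₂ refl refl)
  adj⇒CEdge h | inj₂ (there (there (there (here (inj₁ (refl , refl)))))) = inj₁ (tri₂₀ refl refl)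
  adj⇒CEdge h | inj₂ (there (there (there (here (inj₂ (refl , refl)))))) = inj₂ (tri₂₀ refl refl)

  CEdge⇒adj : ∀ {z y} → CEdge z y → T (adj G z y)
  CEdge⇒adj (along z<k refl) = Any⇒adj G (++⁺ˡ (PathStep⇒pathEdges 0 k _ z≤n z<k))
  CEdge⇒adj (close refl refl) = Any⇒adj G (++⁺ʳ (pathEdges 0 k) (here (inj₁ (refl , refl))))
  CEdge⇒adj (tri₀₁ refl refl) = Any⇒adj G (++⁺ʳ (pathEdges 0 k) (there (here (inj₁ (refl , refl)))))
  CEdge⇒adj (tri₁₂ refl refl) =
    Any⇒adj G (++⁺ʳ (pathEdges 0 k) (there (there (here (inj₁ (refl , refl))))))
  CEdge⇒adj (tri₂₀ refl refl) =
    Any⇒adj G (++⁺ʳ (pathEdges 0 k) (there (there (there (here (inj₁ (refl , refl)))))))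

  inA inT : ℕ → Bool
  inA v = v <ᵇ m
  inT v = (v ≡ᵇ 0) ∨ (k <ᵇ v)

  data InT : ℕ → Set where
    corner₀ : InT 0
    corner₁ : InT (suc k)
    corner₂ : InT (suc (suc k))

  inT⇒InT : ∀ v → v < n → T (inT v) → InT v
  inT⇒InT zero    _   _ = corner₀
  inT⇒InT (suc w) v<n h with m≤n⇒m<n∨m≡n (≤-pred (<ᵇ⇒< k (suc w) h))
  ... | inj₂ refl = corner₁
  ... | inj₁ k<w rewrite ≤-antisym (≤-pred (≤-pred v<n)) k<w = corner₂

  k<⇒inT : ∀ v → k < v → T (inT v)
  k<⇒inT v k<v = from T-∨ (inj₂ (<⇒<ᵇ k<v))

  posT vertexT : ℕ → ℕ
  posT v = v ∸ k
  vertexT zero    = 0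
  vertexT (suc j) = suc (j + k)

  private
    posT₀ : posT 0 ≡ 0
    posT₀ = 0∸n≡0 k

    posT₁ : posT (suc k) ≡ 1
    posT₁ = m+n∸n≡m 1 k

    posT₂ : posT (suc (suc k)) ≡ 2
    posT₂ = m+n∸n≡m 2 k

    posT-InT : ∀ {v} → InT v → posT v < 3
    posT-InT corner₀ rewrite posT₀ = z<s
    posT-InT corner₁ rewrite posT₁ = s≤s z<s
    posT-InT corner₂ rewrite posT₂ = ≤-refl

    posT-injective : ∀ {u v} → InT u → InT v → posT u ≡ posT v → u ≡ v
    posT-injective corner₀ corner₀ _ = refl
    posT-injective corner₁ corner₁ _ = refl
    posT-injective corner₂ corner₂ _ = refl
    posT-injective corner₀ corner₁ e with () ← trans (sym posT₀) (trans e posT₁)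
    posT-injective corner₀ corner₂ e with () ← trans (sym posT₀) (trans e posT₂)
    posT-injective corner₁ corner₀ e with () ← trans (sym posT₁) (trans e posT₀)
    posT-injective corner₁ corner₂ e with () ← trans (sym posT₁) (trans e posT₂)
    posT-injective corner₂ corner₀ e with () ← trans (sym posT₂) (trans e posT₀)
    posT-injective corner₂ corner₁ e with () ← trans (sym posT₂) (trans e posT₁)

    A-edge : ∀ {z y} → T (inA z) → T (inA y) → CEdge z y → CycleAdj m z y
    A-edge _   _   (along _ refl)     = forward refl
    A-edge _   _   (close refl refl)  = wrap refl refl
    A-edge _   y∈A (tri₀₁ refl refl)  = ⊥-elim (<-irrefl refl (<ᵇ⇒< m m y∈A))
    A-edge z∈A _   (tri₁₂ refl refl)  = ⊥-elim (<-irrefl refl (<ᵇ⇒< m m z∈A))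
    A-edge z∈A _   (tri₂₀ refl refl)  = ⊥-elim (<⇒≱ (<ᵇ⇒< _ m z∈A) (n≤1+n m))

    CycleAdj⇒adj-A : ∀ j j′ → j < m → j′ < m → CycleAdj m j j′ → T (adj G j j′)
    CycleAdj⇒adj-A j j′ _ j′<m (forward e) = CEdge⇒adj (along (≤-pred (subst (_< m) (sym e) j′<m)) (sym e))
    CycleAdj⇒adj-A j j′ j<m _ (backward e) =
      adj-sym G (CEdge⇒adj (along (≤-pred (subst (_< m) (sym e) j<m)) (sym e)))
    CycleAdj⇒adj-A j j′ _ _ (wrap e e′)   = CEdge⇒adj (close (suc-injective e) e′)
    CycleAdj⇒adj-A j j′ _ _ (unwrap e e′) = adj-sym G (CEdge⇒adj (close (suc-injective e) e′))

    T-edge : ∀ {z y} → z < n → y < n → T (inT z) → T (inT y) → CEdge z y → CycleAdj 3 (posT z) (posT y)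
    T-edge {z} {y} z<n y<n z∈ y∈ e = go e (inT⇒InT z z<n z∈) (inT⇒InT y y<n y∈)
      where
      go : CEdge z y → InT z → InT y → CycleAdj 3 (posT z) (posT y)
      go (along _ refl) corner₀ corner₁ = ⊥-elim (<⇒≱ z<s 1≤k)
      go (along z<k _) corner₁ _ = ⊥-elim (<-asym z<k (n<1+n k))
      go (along z<k _) corner₂ _ = ⊥-elim (<-asym z<k (m<n⇒m<1+n (n<1+n k)))
      go (close refl _) corner₀ _ = ⊥-elim (<⇒≱ z<s 1≤k)
      go (tri₀₁ refl refl) _ _ rewrite posT₀ | posT₁ = forward refl
      go (tri₁₂ refl refl) _ _ rewrite posT₁ | posT₂ = forward refl
      go (tri₂₀ refl refl) _ _ rewrite posT₀ | posT₂ = wrap refl refl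

    forward-T : ∀ j → suc j < 3 → T (adj G (vertexT j) (vertexT (suc j)))
    forward-T 0 _ = CEdge⇒adj (tri₀₁ refl refl)
    forward-T 1 _ = CEdge⇒adj (tri₁₂ refl refl)
    forward-T (suc (suc _)) (s≤s (s≤s (s≤s ())))

    closing-T : T (adj G (vertexT 2) 0)
    closing-T = CEdge⇒adj (tri₂₀ refl refl)

    CycleAdj⇒adj-T : ∀ j j′ → j < 3 → j′ < 3 → CycleAdj 3 j j′ → T (adj G (vertexT j) (vertexT j′))
    CycleAdj⇒adj-T j _ _ j′<3 (forward refl)  = forward-T j j′<3
    CycleAdj⇒adj-T _ j′ j<3 _ (backward refl) = adj-sym G (forward-T j′ j<3)
    CycleAdj⇒adj-T _ _ _ _ (wrap refl refl)   = closing-T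
    CycleAdj⇒adj-T _ _ _ _ (unwrap refl refl) = adj-sym G closing-T

  cycleA : CycleEmbedding G m
  cycleA = record
    { onCycle       = inA
    ; pos           = id
    ; vertex        = id
    ; pos<          = λ v _ v∈ → <ᵇ⇒< v m v∈
    ; vertex<       = λ j j<m → ≤-trans j<m (m≤n+m m 2)
    ; vertex∈       = λ j j<m → <⇒<ᵇ j<m
    ; pos∘vertex    = λ _ _ → refl
    ; pos-injective = λ _ _ _ _ _ _ e → e
    ; adj⇒CycleAdj  = λ z y _ _ z∈ y∈ h →
        Sum.[ A-edge z∈ y∈ , CycleAdj-sym ∘ A-edge y∈ z∈ ]′ (adj⇒CEdge h)
    ; CycleAdj⇒adj  = CycleAdj⇒adj-A
    }

  triangle : CycleEmbedding G 3
  triangle = record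
    { onCycle       = inT
    ; pos           = posT
    ; vertex        = vertexT
    ; pos<          = λ v v<n v∈ → posT-InT (inT⇒InT v v<n v∈)
    ; vertex<       = vertex<
    ; vertex∈       = vertex∈
    ; pos∘vertex    = pos∘vertex
    ; pos-injective = λ u v u<n v<n u∈ v∈ → posT-injective (inT⇒InT u u<n u∈) (inT⇒InT v v<n v∈)
    ; adj⇒CycleAdj  = λ z y z<n y<n z∈ y∈ h →
        Sum.[ T-edge z<n y<n z∈ y∈ , CycleAdj-sym ∘ T-edge y<n z<n y∈ z∈ ]′ (adj⇒CEdge h)
    ; CycleAdj⇒adj  = CycleAdj⇒adj-T
    }
    where
    vertex< : ∀ j → j < 3 → vertexT j < n
    vertex< 0 _ = z<s
    vertex< 1 _ = s≤s (n≤1+n (suc k))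
    vertex< 2 _ = ≤-refl
    vertex< (suc (suc (suc _))) (s≤s (s≤s (s≤s ())))
    vertex∈ : ∀ j → j < 3 → T (inT (vertexT j))
    vertex∈ 0       _ = tt
    vertex∈ (suc j) _ = k<⇒inT (suc (j + k)) (s≤s (m≤n+m k j))
    pos∘vertex : ∀ j → j < 3 → posT (vertexT j) ≡ j
    pos∘vertex 0       _ = posT₀
    pos∘vertex (suc j) _ = m+n∸n≡m (suc j) k

  private
    local-edge : ∀ {z y} → CEdge z y → T (inA z) × T (inA y) ⊎ T (inT z) × T (inT y)
    local-edge (along z<k refl) = inj₁ (<⇒<ᵇ (m<n⇒m<1+n z<k) , <⇒<ᵇ (s≤s z<k))
    local-edge (close refl refl) = inj₁ (<⇒<ᵇ (n<1+n k) , tt)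
    local-edge (tri₀₁ refl refl) = inj₂ (tt , k<⇒inT _ (n<1+n k))
    local-edge (tri₁₂ refl refl) = inj₂ (k<⇒inT _ (n<1+n k) , k<⇒inT _ (m<n⇒m<1+n (n<1+n k)))
    local-edge (tri₂₀ refl refl) = inj₂ (k<⇒inT _ (m<n⇒m<1+n (n<1+n k)) , tt)

    meet : ∀ v → v < n → T (inA v) → T (inT v) → Portal 0 0 v
    meet v v<n v∈A v∈T with inT⇒InT v v<n v∈T
    ... | corner₀ = inj₁ refl
    ... | corner₁ = ⊥-elim (<-irrefl refl (<ᵇ⇒< m m v∈A))
    ... | corner₂ = ⊥-elim (<⇒≱ (<ᵇ⇒< _ m v∈A) (n≤1+n m))

    cover : ∀ v → T (inA v) ⊎ T (inT v)
    cover v with v <? m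
    ... | yes v<m = inj₁ (<⇒<ᵇ v<m)
    ... | no  v≮m = inj₂ (k<⇒inT v (≮⇒≥ v≮m))

  glue : Gluing G
  glue = record
    { P           = cyclePiece cycleA
    ; Q           = cyclePiece triangle
    ; s₀          = 0
    ; s₁          = 0
    ; portal-in   = λ { _ (inj₁ refl) → z<s , tt , tt ; _ (inj₂ refl) → z<s , tt , tt }
    ; portals-adj = λ 0≢0 → ⊥-elim (0≢0 refl)
    ; cover       = λ v _ → cover v
    ; meet        = meet
    ; local       = λ z y _ _ h → Sum.[ local-edge , Sum.map Prod.swap Prod.swap ∘ local-edge ]′ (adj⇒CEdge h)
    ; P-size      = m≤n⇒m≤1+n (m≤n+m m 2)
    ; Q-size      = s≤s (s≤s (s≤s z≤n))
    ; sizes       = ≤-trans (≤-reflexive (+-comm m 3)) (n≤1+n _)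
    }

  dist-A : ∀ x y → x < m → y < m → dist G x y ≡ cycleDist m x y
  dist-A x y x<m y<m =
    GluedDistance.dist-inside glue x (≤-trans x<m (m≤n+m m 2)) (<⇒<ᵇ x<m) y (≤-trans y<m (m≤n+m m 2)) (<⇒<ᵇ y<m)

  dist-apex : ∀ x y → x < m → m ≤ y → y < n → dist G x y ≡ cycleDist m x 0 + 1
  dist-apex x y x<m m≤y y<n =
    trans (GluedDistance.dist-across glue x (≤-trans x<m (m≤n+m m 2)) (<⇒<ᵇ x<m) y y<n y∉A)
          (trans (cong (λ d → (cycleDist m x 0 + d) ⊓ (cycleDist m x 0 + d)) (apex (inT⇒InT y y<n (k<⇒inT y m≤y))))
                 (⊓-idem _))
    where
    y∉A = λ y∈A → <⇒≱ (<ᵇ⇒< y m y∈A) m≤y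
    apex : InT y → cycleDist 3 (posT 0) (posT y) ≡ 1
    apex corner₀ = ⊥-elim (<⇒≱ z<s m≤y)
    apex corner₁ rewrite posT₀ | posT₁ = refl
    apex corner₂ rewrite posT₀ | posT₂ = refl

  dist-corners : dist G (suc k) (suc (suc k)) ≡ 1
  dist-corners rewrite GluedDistance.dist-inside (swap glue) (suc k) (s≤s (n≤1+n (suc k))) (k<⇒inT _ (n<1+n k))
                         (suc (suc k)) ≤-refl (k<⇒inT _ (m<n⇒m<1+n (n<1+n k)))
                     | posT₁ | posT₂ = refl

-- Wiener indices as sums

∑< : ℕ → (ℕ → ℕ) → ℕ
∑< zero    f = 0
∑< (suc n) f = ∑< n f + f n

syntax ∑< n (λ i → e) = ∑[ i < n ] e

∑-cong : ∀ {f g : ℕ → ℕ} n → (∀ i → i < n → f i ≡ g i) → ∑< n f ≡ ∑< n g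
∑-cong zero    _   = refl
∑-cong (suc n) f≡g = cong₂ _+_ (∑-cong n (λ i i<n → f≡g i (m<n⇒m<1+n i<n))) (f≡g n ≤-refl)

∑-+ : ∀ (f g : ℕ → ℕ) n → ∑[ i < n ] (f i + g i) ≡ ∑< n f + ∑< n g
∑-+ f g zero    = refl
∑-+ f g (suc n) rewrite ∑-+ f g n = interchange (∑< n f) (∑< n g) (f n) (g n)
  where interchange : ∀ a b c d → a + b + (c + d) ≡ a + c + (b + d)
        interchange = solve-∀

∑-const : ∀ c n → ∑[ _ < n ] c ≡ n * c
∑-const c zero    = refl
∑-const c (suc n) rewrite ∑-const c n = +-comm (n * c) c

∑-suc : ∀ (f : ℕ → ℕ) n → ∑[ i < n ] suc (f i) ≡ n + ∑< n f
∑-suc f n = trans (∑-+ (λ _ → 1) f n) (cong (_+ ∑< n f) (trans (∑-const 1 n) (*-identityʳ n)))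

∑-head : ∀ (f : ℕ → ℕ) n → ∑< (suc n) f ≡ f 0 + ∑[ i < n ] f (suc i)
∑-head f zero    = +-comm 0 (f 0)
∑-head f (suc n) rewrite ∑-head f n = +-assoc (f 0) _ _

∑-split : ∀ (f : ℕ → ℕ) m n → ∑< (m + n) f ≡ ∑< m f + ∑[ i < n ] f (m + i)
∑-split f m zero    rewrite +-identityʳ m = sym (+-identityʳ _)
∑-split f m (suc n) rewrite +-suc m n | ∑-split f m n = +-assoc (∑< m f) _ _

∑-reverse : ∀ (h : ℕ → ℕ) n → ∑[ i < n ] h (n ∸ i) ≡ ∑[ i < n ] h (suc i)
∑-reverse h zero    = refl
∑-reverse h (suc n) = begin
  ∑[ i < suc n ] h (suc n ∸ i)      ≡⟨ ∑-head (λ i → h (suc n ∸ i)) n ⟩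
  h (suc n) + ∑[ i < n ] h (n ∸ i)  ≡⟨ cong (h (suc n) +_) (∑-reverse h n) ⟩
  h (suc n) + ∑[ i < n ] h (suc i)  ≡⟨ +-comm (h (suc n)) _ ⟩
  ∑[ i < suc n ] h (suc i)          ∎
  where open ≡-Reasoning

private
  sum-applyUpTo : ∀ (g f : ℕ → ℕ) n → sum (map g (applyUpTo f n)) ≡ ∑[ i < n ] g (f i)
  sum-applyUpTo g f zero    = refl
  sum-applyUpTo g f (suc n) =
    trans (cong (g (f 0) +_) (sum-applyUpTo g (f ∘ suc) n)) (sym (∑-head (g ∘ f) n))

  sum-concatMap : ∀ (h : ℕ → List ℕ) (f : ℕ → ℕ) n →
                  sum (concatMap h (applyUpTo f n)) ≡ ∑[ i < n ] sum (h (f i))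
  sum-concatMap h f zero    = refl
  sum-concatMap h f (suc n) =
    trans (sum-++ (h (f 0)) (concatMap h (applyUpTo (f ∘ suc) n)))
          (trans (cong (sum (h (f 0)) +_) (sum-concatMap h (f ∘ suc) n)) (sym (∑-head (sum ∘ h ∘ f) n)))

wiener-∑ : ∀ G → wiener G ≡ ∑[ y < order G ] ∑[ x < y ] dist G x y
wiener-∑ G = trans (sum-concatMap (λ y → map (λ x → dist G x y) (upTo y)) id (order G))
                   (∑-cong (order G) (λ y _ → sum-applyUpTo (λ x → dist G x y) id y))

arcSum : ℕ → ℕ
arcSum m = ∑[ d < m ] arc m d

cycleWiener : ℕ → ℕ
cycleWiener m = ∑[ y < m ] ∑[ x < y ] cycleDist m x y

arc-shift : ∀ m d → d ≤ m → arc (2 + m) (suc d) ≡ suc (arc m d)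
arc-shift m d d≤m rewrite +-∸-assoc 1 d≤m = refl

arc-last : ∀ m → arc (2 + m) (suc m) ≡ 1
arc-last m rewrite m+n∸n≡m 1 m | ⊓-zeroʳ m = refl

arc-self : ∀ m → arc m m ≡ 0
arc-self m rewrite n∸n≡0 m = ⊓-zeroʳ m

arcSum-rec : ∀ m → arcSum (2 + m) ≡ arcSum m + m + 1
arcSum-rec m = begin
  ∑[ d < suc m ] arc (2 + m) d + arc (2 + m) (suc m)
    ≡⟨ cong₂ _+_ (∑-head (arc (2 + m)) m) (arc-last m) ⟩
  ∑[ d < m ] arc (2 + m) (suc d) + 1
    ≡⟨ cong (_+ 1) (∑-cong m (λ d d<m → arc-shift m d (<⇒≤ d<m))) ⟩
  ∑[ d < m ] suc (arc m d) + 1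
    ≡⟨ cong (_+ 1) (trans (∑-suc (arc m) m) (+-comm m (arcSum m))) ⟩
  arcSum m + m + 1
    ∎
  where open ≡-Reasoning

cycleDist-row : ∀ m y → ∑[ x < y ] cycleDist m x y ≡ ∑[ d < y ] arc m (suc d)
cycleDist-row m y =
  trans (∑-cong y (λ x x<y → cong (arc m) (m≤n⇒∣m-n∣≡n∸m (<⇒≤ x<y)))) (∑-reverse (arc m) y)

private
  arcRows : ℕ → ℕ
  arcRows m = ∑[ y < m ] ∑[ d < y ] arc m (suc d)

  2*∑[i<1+n]i : ∀ n → 2 * ∑[ i < suc n ] i ≡ suc n * n
  2*∑[i<1+n]i zero    = refl
  2*∑[i<1+n]i (suc n) = begin
    2 * (∑[ i < suc n ] i + suc n)   ≡⟨ *-distribˡ-+ 2 (∑[ i < suc n ] i) (suc n) ⟩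
    2 * ∑[ i < suc n ] i + 2 * suc n ≡⟨ cong (_+ 2 * suc n) (2*∑[i<1+n]i n) ⟩
    suc n * n + 2 * suc n            ≡⟨ step n ⟩
    suc (suc n) * suc n              ∎
    where open ≡-Reasoning
          step : ∀ n → suc n * n + 2 * suc n ≡ suc (suc n) * suc n
          step = solve-∀

  arcRows-rec : ∀ m → arcRows (2 + m) ≡ arcRows m + arcSum m + ∑[ i < 2 + m ] i
  arcRows-rec m = begin
    arcRows (2 + m)
      ≡⟨ ∑-cong (2 + m) (λ y y<2+m → trans (∑-cong y (λ d d<y → arc-shift m d (≤-pred (≤-trans d<y (≤-pred y<2+m)))))
                                           (∑-suc (arc m) y)) ⟩
    ∑[ y < 2 + m ] (y + row y)
      ≡⟨ ∑-+ id row (2 + m) ⟩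
    ∑[ i < 2 + m ] i + (∑< (suc m) row + row (suc m))
      ≡⟨ cong (λ r → ∑[ i < 2 + m ] i + (r + row (suc m))) (∑-head row m) ⟩
    ∑[ i < 2 + m ] i + (∑[ y < m ] row (suc y) + (arcSum m + arc m m))
      ≡⟨ cong₂ (λ r s → ∑[ i < 2 + m ] i + (r + (arcSum m + s)))
               (∑-cong m (λ y _ → ∑-head (arc m) y)) (arc-self m) ⟩
    ∑[ i < 2 + m ] i + (arcRows m + (arcSum m + 0))
      ≡⟨ rearrange (∑[ i < 2 + m ] i) (arcRows m) (arcSum m) ⟩
    arcRows m + arcSum m + ∑[ i < 2 + m ] i
      ∎
    where
    open ≡-Reasoning
    row : ℕ → ℕ
    row y = ∑[ d < y ] arc m d
    rearrange : ∀ t w s → t + (w + (s + 0)) ≡ w + s + t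
    rearrange = solve-∀

  2*arcRows : ∀ m → 2 * arcRows m ≡ m * arcSum m
  2*arcRows zero          = refl
  2*arcRows (suc zero)    = refl
  2*arcRows (suc (suc m)) = begin
    2 * arcRows (2 + m)                                    ≡⟨ cong (2 *_) (arcRows-rec m) ⟩
    2 * (arcRows m + arcSum m + ∑[ i < 2 + m ] i)          ≡⟨ distrib (arcRows m) (arcSum m) (∑[ i < 2 + m ] i) ⟩
    2 * arcRows m + 2 * arcSum m + 2 * ∑[ i < 2 + m ] i    ≡⟨ cong₂ (λ r t → r + 2 * arcSum m + t) (2*arcRows m) (2*∑[i<1+n]i (suc m)) ⟩
    m * arcSum m + 2 * arcSum m + (2 + m) * suc m          ≡⟨ collect m (arcSum m) ⟩
    (2 + m) * (arcSum m + m + 1)                           ≡⟨ cong ((2 + m) *_) (arcSum-rec m) ⟨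
    (2 + m) * arcSum (2 + m)                               ∎
    where
    open ≡-Reasoning
    distrib : ∀ a b c → 2 * (a + b + c) ≡ 2 * a + 2 * b + 2 * c
    distrib = solve-∀
    collect : ∀ m s → m * s + 2 * s + (2 + m) * suc m ≡ (2 + m) * (s + m + 1)
    collect = solve-∀

2*cycleWiener : ∀ m → 2 * cycleWiener m ≡ m * arcSum m
2*cycleWiener m = trans (cong (2 *_) (∑-cong m (λ y _ → cycleDist-row m y))) (2*arcRows m)

-- portalSum r u v adds, over the r vertices of C_{r+2} off the edge {0,1}, the length of the
-- shorter route to a vertex at distance u from 0 and v from 1.
portalSum : ℕ → ℕ → ℕ → ℕ
portalSum r u v = ∑[ i < r ] ((arc (2 + r) (2 + i) + u) ⊓ (arc (2 + r) (1 + i) + v))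

crossSum : ℕ → ℕ → ℕ
crossSum p q = ∑[ t < q ] portalSum p (arc (2 + q) (2 + t)) (arc (2 + q) (1 + t))

wiener-C3 : ∀ k → 1 ≤ k → wiener (C3 (3 + k)) ≡ cycleWiener (suc k) + 2 * (arcSum (suc k) + suc k) + 1
wiener-C3 k 1≤k = begin
  wiener G
    ≡⟨ wiener-∑ G ⟩
  ∑< m row + row m + row (suc m)
    ≡⟨ cong₂ (λ w r → w + r + row (suc m)) cycle-rows (apex-row m (λ x x<m → dist-apex x m x<m ≤-refl (m<n⇒m<1+n (n<1+n m)))) ⟩
  cycleWiener m + (arcSum m + m) + (∑[ x < m ] dist G x (suc m) + dist G m (suc m))
    ≡⟨ cong₂ (λ r d → cycleWiener m + (arcSum m + m) + (r + d))
             (apex-row (suc m) (λ x x<m → dist-apex x (suc m) x<m (n≤1+n m) ≤-refl)) dist-corners ⟩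
  cycleWiener m + (arcSum m + m) + (arcSum m + m + 1)
    ≡⟨ collect (cycleWiener m) (arcSum m + m) ⟩
  cycleWiener m + 2 * (arcSum m + m) + 1
    ∎
  where
  open ≡-Reasoning
  open C3Graph k 1≤k
  row : ℕ → ℕ
  row y = ∑[ x < y ] dist G x y
  cycle-rows : ∑< m row ≡ cycleWiener m
  cycle-rows = ∑-cong m (λ y y<m → ∑-cong y (λ x x<y → dist-A x y (<-trans x<y y<m) y<m))
  apex-row : ∀ y → (∀ x → x < m → dist G x y ≡ cycleDist m x 0 + 1) → ∑[ x < m ] dist G x y ≡ arcSum m + m
  apex-row y dist≡ = begin
    ∑[ x < m ] dist G x y           ≡⟨ ∑-cong m (λ x x<m → trans (dist≡ x x<m) (cong (λ d → arc m d + 1) (∣-∣-identityʳ x))) ⟩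
    ∑[ x < m ] (arc m x + 1)        ≡⟨ ∑-+ (arc m) (λ _ → 1) m ⟩
    arcSum m + ∑[ _ < m ] 1         ≡⟨ cong (arcSum m +_) (trans (∑-const 1 m) (*-identityʳ m)) ⟩
    arcSum m + m                    ∎
  collect : ∀ w s → w + s + (s + 1) ≡ w + 2 * s + 1
  collect = solve-∀

-- The +1 accounts for the shared edge {0,1}, whose length is counted in both cycle sums.
wiener-F : ∀ p q → 1 ≤ p → 1 ≤ q →
           wiener (F (2 + p + q) (2 + p)) + 1 ≡ cycleWiener (2 + p) + cycleWiener (2 + q) + crossSum p q
wiener-F p q 1≤p 1≤q = begin
  wiener G + 1
    ≡⟨ cong (_+ 1) (trans (wiener-∑ G) (∑-split row a q)) ⟩
  ∑< a row + ∑[ t < q ] row (a + t) + 1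
    ≡⟨ cong₂ (λ w r → w + r + 1) A-rows (trans (∑-cong q row-beyond) (∑-+ (rowL ∘ (2 +_)) across q)) ⟩
  cycleWiener a + (∑[ t < q ] rowL (2 + t) + crossSum p q) + 1
    ≡⟨ rearrange (cycleWiener a) (∑[ t < q ] rowL (2 + t)) (crossSum p q) ⟩
  cycleWiener a + (1 + ∑[ t < q ] rowL (2 + t)) + crossSum p q
    ≡⟨ cong (λ w → cycleWiener a + w + crossSum p q) (∑-split rowL 2 q) ⟨
  cycleWiener a + cycleWiener L + crossSum p q
    ∎
  where
  open ≡-Reasoning
  open FGraph p q 1≤p 1≤q
  row rowL across : ℕ → ℕ
  row y    = ∑[ x < y ] dist G x y
  rowL y   = ∑[ x < y ] cycleDist L x y
  across t = portalSum p (arc L (2 + t)) (arc L (1 + t))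

  A-rows : ∑< a row ≡ cycleWiener a
  A-rows = ∑-cong a (λ y y<a → ∑-cong y (λ x x<y → dist-A x y (<-trans x<y y<a) y<a))

  posB-portal : ∀ x → x < 2 → posB x ≡ x
  posB-portal 0 _ = refl
  posB-portal 1 _ = refl
  posB-portal (suc (suc _)) (s≤s (s≤s ()))

  row-beyond : ∀ t → t < q → row (a + t) ≡ rowL (2 + t) + across t
  row-beyond t t<q = begin
    row (a + t)
      ≡⟨ ∑-split (λ x → dist G x y) 2 (p + t) ⟩
    ∑[ x < 2 ] dist G x y + ∑[ j < p + t ] dist G (2 + j) y
      ≡⟨ cong (∑[ x < 2 ] dist G x y +_) (∑-split (λ j → dist G (2 + j) y) p t) ⟩
    ∑[ x < 2 ] dist G x y + (∑[ i < p ] dist G (2 + i) y + ∑[ s < t ] dist G (a + s) y)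
      ≡⟨ cong₂ (λ u w → u + w) portal-part (cong₂ _+_ (∑-cong p (λ i i<p → dist-across i t i<p t<q)) B-part) ⟩
    ∑[ x < 2 ] cycleDist L x (2 + t) + (across t + ∑[ s < t ] cycleDist L (2 + s) (2 + t))
      ≡⟨ rearrange′ (∑[ x < 2 ] cycleDist L x (2 + t)) (across t) _ ⟩
    ∑[ x < 2 ] cycleDist L x (2 + t) + ∑[ s < t ] cycleDist L (2 + s) (2 + t) + across t
      ≡⟨ cong (_+ across t) (∑-split (λ x → cycleDist L x (2 + t)) 2 t) ⟨
    rowL (2 + t) + across t
      ∎
    where
    y = a + t
    y<n = +-monoʳ-< a t<q
    portal-part : ∑[ x < 2 ] dist G x y ≡ ∑[ x < 2 ] cycleDist L x (2 + t)
    portal-part = ∑-cong 2 (λ x x<2 →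
      trans (dist-B x y (<-≤-trans x<2 (m≤m+n 2 (p + q))) y<n (from T-∨ (inj₁ (<⇒<ᵇ x<2))) (a≤⇒inB y (m≤m+n a t)))
            (cong₂ (cycleDist L) (posB-portal x x<2) (posB-a+ t)))
    B-part : ∑[ s < t ] dist G (a + s) y ≡ ∑[ s < t ] cycleDist L (2 + s) (2 + t)
    B-part = ∑-cong t (λ s s<t →
      trans (dist-B (a + s) y (<-trans (+-monoʳ-< a s<t) y<n) y<n (a≤⇒inB _ (m≤m+n a s)) (a≤⇒inB y (m≤m+n a t)))
            (cong₂ (cycleDist L) (posB-a+ s) (posB-a+ t)))
    rearrange′ : ∀ u c w → u + (c + w) ≡ u + w + c
    rearrange′ = solve-∀

  rearrange : ∀ w r c → w + (r + c) + 1 ≡ w + (1 + r) + c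
  rearrange = solve-∀

portalSum-rec : ∀ r u v →
  portalSum (2 + r) u v ≡ (2 + u) ⊓ (1 + v) + (r + portalSum r u v) + (1 + u) ⊓ (2 + v)
portalSum-rec r u v = begin
  ∑< (suc r) term + term (suc r)
    ≡⟨ cong₂ _+_ (∑-head term r) (cong₂ (λ d e → (d + u) ⊓ (e + v)) (arc-last (2 + r)) arc-penultimate) ⟩
  (2 + u) ⊓ (1 + v) + ∑[ i < r ] term (suc i) + (1 + u) ⊓ (2 + v)
    ≡⟨ cong (λ s → (2 + u) ⊓ (1 + v) + s + (1 + u) ⊓ (2 + v))
            (trans (∑-cong r (λ i i<r → cong₂ (λ d e → (d + u) ⊓ (e + v))
                                               (arc-shift (2 + r) (2 + i) (s≤s (s≤s (<⇒≤ i<r))))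
                                               (arc-shift (2 + r) (1 + i) (s≤s (<⇒≤ (m<n⇒m<1+n i<r))))))
                   (∑-suc _ r)) ⟩
  (2 + u) ⊓ (1 + v) + (r + portalSum r u v) + (1 + u) ⊓ (2 + v)
    ∎
  where
  open ≡-Reasoning
  term : ℕ → ℕ
  term i = (arc (4 + r) (2 + i) + u) ⊓ (arc (4 + r) (1 + i) + v)
  arc-penultimate : arc (4 + r) (2 + r) ≡ 2
  arc-penultimate rewrite m+n∸n≡m 2 r | ⊓-zeroʳ r = refl

crossSum-rec : ∀ p q → crossSum (2 + p) q ≡ q * suc p + crossSum p q + (portalSum q 1 0 + portalSum q 1 2)
crossSum-rec p q = begin
  crossSum (2 + p) q
    ≡⟨ ∑-cong q (λ t _ → trans (portalSum-rec p (U₀ t) (U₁ t)) (regroup t)) ⟩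
  ∑[ t < q ] (suc p + portalSum p (U₀ t) (U₁ t) + ((U₀ t + 1) ⊓ (U₁ t + 0) + (U₀ t + 1) ⊓ (U₁ t + 2)))
    ≡⟨ trans (∑-+ _ W q) (cong (_+ ∑< q W) (∑-+ _ _ q)) ⟩
  ∑[ _ < q ] suc p + crossSum p q + ∑< q W
    ≡⟨ cong₂ (λ c s → c + crossSum p q + s) (∑-const (suc p) q) (∑-+ _ _ q) ⟩
  q * suc p + crossSum p q + (portalSum q 1 0 + portalSum q 1 2)
    ∎
  where
  open ≡-Reasoning
  U₀ U₁ : ℕ → ℕ
  U₀ t = arc (2 + q) (2 + t)
  U₁ t = arc (2 + q) (1 + t)
  W : ℕ → ℕ
  W t = (U₀ t + 1) ⊓ (U₁ t + 0) + (U₀ t + 1) ⊓ (U₁ t + 2)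
  regroup : ∀ t → let X = (1 + U₀ t) ⊓ U₁ t ; Y = (1 + U₀ t) ⊓ (2 + U₁ t) ; Ψ = portalSum p (U₀ t) (U₁ t) in
            suc X + (p + Ψ) + Y ≡ suc p + Ψ + W t
  regroup t = trans (shuffle p (portalSum p (U₀ t) (U₁ t)) ((1 + U₀ t) ⊓ U₁ t) ((1 + U₀ t) ⊓ (2 + U₁ t)))
                    (cong (λ w → suc p + portalSum p (U₀ t) (U₁ t) + w)
                          (cong₂ _+_ (cong₂ _⊓_ (+-comm 1 (U₀ t)) (sym (+-identityʳ (U₁ t))))
                                     (cong₂ _⊓_ (+-comm 1 (U₀ t)) (+-comm 2 (U₁ t)))))
    where shuffle : ∀ p s x y → suc x + (p + s) + y ≡ suc p + s + (x + y)
          shuffle = solve-∀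

-- Closed forms by parity

double : ℕ → ℕ
double zero    = zero
double (suc l) = 2 + double l

double≡ : ∀ l → double l ≡ l + l
double≡ zero    = refl
double≡ (suc l) = cong suc (trans (cong suc (double≡ l)) (sym (+-suc l l)))

double-+ : ∀ l k → double l + double k ≡ double (l + k)
double-+ zero    k = refl
double-+ (suc l) k = cong (2 +_) (double-+ l k)

arcSum-even : ∀ l → arcSum (double l) ≡ l * l
arcSum-even zero    = refl
arcSum-even (suc l) = begin
  arcSum (2 + double l)        ≡⟨ arcSum-rec (double l) ⟩
  arcSum (double l) + double l + 1 ≡⟨ cong₂ (λ s d → s + d + 1) (arcSum-even l) (double≡ l) ⟩
  l * l + (l + l) + 1          ≡⟨ square-suc l ⟩
  suc l * suc l                ∎
  where open ≡-Reasoning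
        square-suc : ∀ l → l * l + (l + l) + 1 ≡ suc l * suc l
        square-suc = solve-∀

arcSum-odd : ∀ l → arcSum (suc (double l)) ≡ l * l + l
arcSum-odd zero    = refl
arcSum-odd (suc l) = begin
  arcSum (2 + suc (double l))                ≡⟨ arcSum-rec (suc (double l)) ⟩
  arcSum (suc (double l)) + suc (double l) + 1 ≡⟨ cong₂ (λ s d → s + suc d + 1) (arcSum-odd l) (double≡ l) ⟩
  l * l + l + suc (l + l) + 1                ≡⟨ step l ⟩
  suc l * suc l + suc l                      ∎
  where open ≡-Reasoning
        step : ∀ l → l * l + l + suc (l + l) + 1 ≡ suc l * suc l + suc l
        step = solve-∀

cycleWiener-even : ∀ l → 2 * cycleWiener (double l) ≡ (l + l) * (l * l)
cycleWiener-even l rewrite 2*cycleWiener (double l) | arcSum-even l | double≡ l = refl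

cycleWiener-odd : ∀ l → 2 * cycleWiener (suc (double l)) ≡ suc (l + l) * (l * l + l)
cycleWiener-odd l rewrite 2*cycleWiener (suc (double l)) | arcSum-odd l | double≡ l = refl

portalSum-even : ∀ u v l → portalSum (double l) u v ≡ l * l + ((1 + u) ⊓ v + (1 + u) ⊓ (2 + v)) * l
portalSum-even u v zero    = sym (*-zeroʳ ((1 + u) ⊓ v + (1 + u) ⊓ (2 + v)))
portalSum-even u v (suc l) = begin
  portalSum (2 + double l) u v
    ≡⟨ portalSum-rec (double l) u v ⟩
  suc A + (double l + portalSum (double l) u v) + B
    ≡⟨ cong₂ (λ d s → suc A + (d + s) + B) (double≡ l) (portalSum-even u v l) ⟩
  suc A + (l + l + (l * l + (A + B) * l)) + B
    ≡⟨ step l A B ⟩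
  suc l * suc l + (A + B) * suc l
    ∎
  where
  open ≡-Reasoning
  A = (1 + u) ⊓ v
  B = (1 + u) ⊓ (2 + v)
  step : ∀ l a b → suc a + (l + l + (l * l + (a + b) * l)) + b ≡ suc l * suc l + (a + b) * suc l
  step = solve-∀

portalSum-odd : ∀ u v l →
  portalSum (suc (double l)) u v ≡ (1 + u) ⊓ (1 + v) + l * l + ((2 + u) ⊓ (1 + v) + (1 + u) ⊓ (2 + v)) * l
portalSum-odd u v zero    = sym (trans (cong ((1 + u) ⊓ (1 + v) + 0 +_) (*-zeroʳ ((2 + u) ⊓ (1 + v) + (1 + u) ⊓ (2 + v))))
                                       (trans (+-identityʳ _) (+-identityʳ _)))
portalSum-odd u v (suc l) = begin
  portalSum (2 + suc (double l)) u v
    ≡⟨ portalSum-rec (suc (double l)) u v ⟩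
  A + (suc (double l) + portalSum (suc (double l)) u v) + B
    ≡⟨ cong₂ (λ d s → A + (suc d + s) + B) (double≡ l) (portalSum-odd u v l) ⟩
  A + (suc (l + l) + (C + l * l + (A + B) * l)) + B
    ≡⟨ step l A B C ⟩
  C + suc l * suc l + (A + B) * suc l
    ∎
  where
  open ≡-Reasoning
  A = (2 + u) ⊓ (1 + v)
  B = (1 + u) ⊓ (2 + v)
  C = (1 + u) ⊓ (1 + v)
  step : ∀ l a b c → a + (suc (l + l) + (c + l * l + (a + b) * l)) + b ≡ c + suc l * suc l + (a + b) * suc l
  step = solve-∀

crossSum-even : ∀ q j → crossSum (double j) q ≡ q * (j * j) + j * (portalSum q 1 0 + portalSum q 1 2)
crossSum-even q zero    = trans (∑-const 0 q) (trans (*-zeroʳ q) (sym (trans (+-identityʳ _) (*-zeroʳ q))))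
crossSum-even q (suc j) = begin
  crossSum (2 + double j) q                      ≡⟨ crossSum-rec (double j) q ⟩
  q * suc (double j) + crossSum (double j) q + S ≡⟨ cong₂ (λ d c → q * suc d + c + S) (double≡ j) (crossSum-even q j) ⟩
  q * suc (j + j) + (q * (j * j) + j * S) + S    ≡⟨ step q j S ⟩
  q * (suc j * suc j) + suc j * S                ∎
  where
  open ≡-Reasoning
  S = portalSum q 1 0 + portalSum q 1 2
  step : ∀ q j s → q * suc (j + j) + (q * (j * j) + j * s) + s ≡ q * (suc j * suc j) + suc j * s
  step = solve-∀

crossSum-odd : ∀ q j →
  crossSum (suc (double j)) q ≡ q + portalSum q 0 0 + q * (j * j + j) + j * (portalSum q 1 0 + portalSum q 1 2)
crossSum-odd q zero    = begin
  crossSum 1 q                                ≡⟨ ∑-suc _ q ⟩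
  q + ∑[ t < q ] (U₀ t ⊓ U₁ t)                 ≡⟨ cong (q +_) (∑-cong q (λ t _ → sym (cong₂ _⊓_ (+-identityʳ (U₀ t)) (+-identityʳ (U₁ t))))) ⟩
  q + portalSum q 0 0                         ≡⟨ trans (+-identityʳ _) (trans (cong (q + portalSum q 0 0 +_) (*-zeroʳ q)) (+-identityʳ _)) ⟨
  q + portalSum q 0 0 + q * 0 + 0 * (portalSum q 1 0 + portalSum q 1 2) ∎
  where
  open ≡-Reasoning
  U₀ U₁ : ℕ → ℕ
  U₀ t = arc (2 + q) (2 + t)
  U₁ t = arc (2 + q) (1 + t)
crossSum-odd q (suc j) = begin
  crossSum (2 + suc (double j)) q                      ≡⟨ crossSum-rec (suc (double j)) q ⟩
  q * suc (suc (double j)) + crossSum (suc (double j)) q + S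
    ≡⟨ cong₂ (λ d c → q * suc (suc d) + c + S) (double≡ j) (crossSum-odd q j) ⟩
  q * suc (suc (j + j)) + (q + R + q * (j * j + j) + j * S) + S
    ≡⟨ step q j R S ⟩
  q + R + q * (suc j * suc j + suc j) + suc j * S      ∎
  where
  open ≡-Reasoning
  R = portalSum q 0 0
  S = portalSum q 1 0 + portalSum q 1 2
  step : ∀ q j r s → q * suc (suc (j + j)) + (q + r + q * (j * j + j) + j * s) + s ≡
                     q + r + q * (suc j * suc j + suc j) + suc j * s
  step = solve-∀

data EvenOdd : ℕ → Set where
  even : ∀ l → EvenOdd (double l)
  odd  : ∀ l → EvenOdd (suc (double l))

evenOdd : ∀ n → EvenOdd n
evenOdd zero = even 0
evenOdd (suc n) with evenOdd n
... | even l = odd l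
... | odd l  = even (suc l)

gap-from-closed-forms : ∀ p q {Δ w₁ w₂ c w₃ s r} →
      2 * cycleWiener (2 + p) ≡ w₁ → 2 * cycleWiener (2 + q) ≡ w₂ → crossSum p q ≡ c →
      2 * cycleWiener (p + q) ≡ w₃ → arcSum (p + q) ≡ s → p + q ≡ r →
      4 * w₁ + 4 * w₂ + 8 * c + Δ ≡ 4 * w₃ + 16 * (s + r) + 16 →
      8 * (cycleWiener (2 + p) + cycleWiener (2 + q) + crossSum p q) + Δ ≡
      8 * (cycleWiener (p + q) + 2 * (arcSum (p + q) + (p + q)) + 1) + 8
gap-from-closed-forms p q {Δ} refl refl refl refl refl refl poly =
  trans (expand (cycleWiener (2 + p)) (cycleWiener (2 + q)) (crossSum p q) Δ)
        (trans poly (collect (cycleWiener (p + q)) (arcSum (p + q)) (p + q)))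
  where
  expand : ∀ x₁ x₂ c Δ → 8 * (x₁ + x₂ + c) + Δ ≡ 4 * (2 * x₁) + 4 * (2 * x₂) + 8 * c + Δ
  expand = solve-∀
  collect : ∀ x s r → 4 * (2 * x) + 16 * (s + r) + 16 ≡ 8 * (x + 2 * (s + r) + 1) + 8
  collect = solve-∀

-- In each parity case, the extra summand is 8 (W(C_{n,3}) - W(F_{n,a})) as a polynomial in the
-- half-lengths l and k; it vanishes only for p = 2 or q = 2.
gap-even-even : ∀ l k → let p = double (suc l) ; q = double (suc k) in
  8 * (cycleWiener (2 + p) + cycleWiener (2 + q) + crossSum p q) + (16 * l * k + 8 * l * k * k + 8 * l * l * k) ≡
  8 * (cycleWiener (p + q) + 2 * (arcSum (p + q) + (p + q)) + 1) + 8
gap-even-even l k = gap-from-closed-forms (double (suc l)) (double (suc k))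
  (cycleWiener-even (2 + l))
  (cycleWiener-even (2 + k))
  (trans (crossSum-even (double (suc k)) (suc l))
         (cong₂ (λ q s → q * (suc l * suc l) + suc l * s) (double≡ (suc k))
                (cong₂ _+_ (portalSum-even 1 0 (suc k)) (portalSum-even 1 2 (suc k)))))
  (trans (cong (λ x → 2 * cycleWiener x) (double-+ (suc l) (suc k))) (cycleWiener-even (suc l + suc k)))
  (trans (cong arcSum (double-+ (suc l) (suc k))) (arcSum-even (suc l + suc k)))
  (trans (double-+ (suc l) (suc k)) (double≡ (suc l + suc k)))
  (poly l k)
  where
  poly : ∀ l k → let L = suc l ; K = suc k ; M = L + K in
    4 * ((suc L + suc L) * (suc L * suc L)) + 4 * ((suc K + suc K) * (suc K * suc K)) +
    8 * ((K + K) * (L * L) + L * ((K * K + 2 * K) + (K * K + 4 * K))) + (16 * l * k + 8 * l * k * k + 8 * l * l * k) ≡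
    4 * ((M + M) * (M * M)) + 16 * (M * M + (M + M)) + 16
  poly = solve-∀

gap-even-odd : ∀ l k → let p = double (suc l) ; q = suc (double (suc k)) in
  8 * (cycleWiener (2 + p) + cycleWiener (2 + q) + crossSum p q) +
    (12 * l + 24 * l * k + 8 * l * k * k + 4 * l * l + 8 * l * l * k) ≡
  8 * (cycleWiener (p + q) + 2 * (arcSum (p + q) + (p + q)) + 1) + 8
gap-even-odd l k = gap-from-closed-forms (double (suc l)) (suc (double (suc k)))
  (cycleWiener-even (2 + l))
  (cycleWiener-odd (2 + k))
  (trans (crossSum-even (suc (double (suc k))) (suc l))
         (cong₂ (λ q s → suc q * (suc l * suc l) + suc l * s) (double≡ (suc k))
                (cong₂ _+_ (portalSum-odd 1 0 (suc k)) (portalSum-odd 1 2 (suc k)))))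
  (trans (cong (λ x → 2 * cycleWiener x) p+q) (cycleWiener-odd (suc l + suc k)))
  (trans (cong arcSum p+q) (arcSum-odd (suc l + suc k)))
  (trans p+q (cong suc (double≡ (suc l + suc k))))
  (poly l k)
  where
  p+q : double (suc l) + suc (double (suc k)) ≡ suc (double (suc l + suc k))
  p+q = trans (+-suc (double (suc l)) _) (cong suc (double-+ (suc l) (suc k)))
  poly : ∀ l k → let L = suc l ; K = suc k ; M = L + K in
    4 * ((suc L + suc L) * (suc L * suc L)) + 4 * (suc (suc K + suc K) * (suc K * suc K + suc K)) +
    8 * (suc (K + K) * (L * L) + L * ((1 + K * K + 3 * K) + (2 + K * K + 5 * K))) +
    (12 * l + 24 * l * k + 8 * l * k * k + 4 * l * l + 8 * l * l * k) ≡
    4 * (suc (M + M) * (M * M + M)) + 16 * (M * M + M + suc (M + M)) + 16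
  poly = solve-∀

gap-odd-even : ∀ l k → let p = suc (double (suc l)) ; q = double (suc k) in
  8 * (cycleWiener (2 + p) + cycleWiener (2 + q) + crossSum p q) +
    (12 * k + 4 * k * k + 24 * l * k + 8 * l * k * k + 8 * l * l * k) ≡
  8 * (cycleWiener (p + q) + 2 * (arcSum (p + q) + (p + q)) + 1) + 8
gap-odd-even l k = gap-from-closed-forms (suc (double (suc l))) (double (suc k))
  (cycleWiener-odd (2 + l))
  (cycleWiener-even (2 + k))
  (trans (crossSum-odd (double (suc k)) (suc l))
         (cong₂ (λ q (r , s) → q + r + q * (suc l * suc l + suc l) + suc l * s) (double≡ (suc k))
                (cong₂ _,_ (portalSum-even 0 0 (suc k))
                           (cong₂ _+_ (portalSum-even 1 0 (suc k)) (portalSum-even 1 2 (suc k))))))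
  (trans (cong (λ x → 2 * cycleWiener x) p+q) (cycleWiener-odd (suc l + suc k)))
  (trans (cong arcSum p+q) (arcSum-odd (suc l + suc k)))
  (trans p+q (cong suc (double≡ (suc l + suc k))))
  (poly l k)
  where
  p+q : suc (double (suc l)) + double (suc k) ≡ suc (double (suc l + suc k))
  p+q = cong suc (double-+ (suc l) (suc k))
  poly : ∀ l k → let L = suc l ; K = suc k ; M = L + K in
    4 * (suc (suc L + suc L) * (suc L * suc L + suc L)) + 4 * ((suc K + suc K) * (suc K * suc K)) +
    8 * ((K + K) + (K * K + 1 * K) + (K + K) * (L * L + L) + L * ((K * K + 2 * K) + (K * K + 4 * K))) +
    (12 * k + 4 * k * k + 24 * l * k + 8 * l * k * k + 8 * l * l * k) ≡
    4 * (suc (M + M) * (M * M + M)) + 16 * (M * M + M + suc (M + M)) + 16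
  poly = solve-∀

gap-odd-odd : ∀ l k → let p = suc (double (suc l)) ; q = suc (double (suc k)) in
  8 * (cycleWiener (2 + p) + cycleWiener (2 + q) + crossSum p q) +
    (24 + 20 * k + 4 * k * k + 20 * l + 32 * l * k + 8 * l * k * k + 4 * l * l + 8 * l * l * k) ≡
  8 * (cycleWiener (p + q) + 2 * (arcSum (p + q) + (p + q)) + 1) + 8
gap-odd-odd l k = gap-from-closed-forms (suc (double (suc l))) (suc (double (suc k)))
  (cycleWiener-odd (2 + l))
  (cycleWiener-odd (2 + k))
  (trans (crossSum-odd (suc (double (suc k))) (suc l))
         (cong₂ (λ q (r , s) → suc q + r + suc q * (suc l * suc l + suc l) + suc l * s) (double≡ (suc k))
                (cong₂ _,_ (portalSum-odd 0 0 (suc k))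
                           (cong₂ _+_ (portalSum-odd 1 0 (suc k)) (portalSum-odd 1 2 (suc k))))))
  (trans (cong (λ x → 2 * cycleWiener x) p+q) (cycleWiener-even (suc (suc l + suc k))))
  (trans (cong arcSum p+q) (arcSum-even (suc (suc l + suc k))))
  (trans p+q (double≡ (suc (suc l + suc k))))
  (poly l k)
  where
  p+q : suc (double (suc l)) + suc (double (suc k)) ≡ double (suc (suc l + suc k))
  p+q = cong suc (trans (+-suc (double (suc l)) _) (cong suc (double-+ (suc l) (suc k))))
  poly : ∀ l k → let L = suc l ; K = suc k ; M = suc (L + K) in
    4 * (suc (suc L + suc L) * (suc L * suc L + suc L)) + 4 * (suc (suc K + suc K) * (suc K * suc K + suc K)) +
    8 * (suc (K + K) + (1 + K * K + 2 * K) + suc (K + K) * (L * L + L) + L * ((1 + K * K + 3 * K) + (2 + K * K + 5 * K))) +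
    (24 + 20 * k + 4 * k * k + 20 * l + 32 * l * k + 8 * l * k * k + 4 * l * l + 8 * l * l * k) ≡
    4 * ((M + M) * (M * M)) + 16 * (M * M + (M + M)) + 16
  poly = solve-∀

private
  even-even-zero : ∀ l k → 16 * l * k + 8 * l * k * k + 8 * l * l * k ≡ 0 → double l ≡ 0 ⊎ double k ≡ 0
  even-even-zero zero    k       _  = inj₁ refl
  even-even-zero (suc l) zero    _  = inj₂ refl
  even-even-zero (suc l) (suc k) ()

  even-odd-zero : ∀ l k → 12 * l + 24 * l * k + 8 * l * k * k + 4 * l * l + 8 * l * l * k ≡ 0 → double l ≡ 0
  even-odd-zero zero    k _  = refl
  even-odd-zero (suc l) k ()

  odd-even-zero : ∀ l k → 12 * k + 4 * k * k + 24 * l * k + 8 * l * k * k + 8 * l * l * k ≡ 0 → double k ≡ 0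
  odd-even-zero l zero    _  = refl
  odd-even-zero l (suc k) ()

gap-by-parity : ∀ P Q → let p = suc (suc P) ; q = suc (suc Q) in
  ∃[ Δ ] 8 * (cycleWiener (2 + p) + cycleWiener (2 + q) + crossSum p q) + Δ ≡
         8 * (cycleWiener (p + q) + 2 * (arcSum (p + q) + (p + q)) + 1) + 8 ×
         (Δ ≡ 0 → P ≡ 0 ⊎ Q ≡ 0)
gap-by-parity P Q with evenOdd P | evenOdd Q
... | even l | even k = _ , gap-even-even l k , even-even-zero l k
... | even l | odd k  = _ , gap-even-odd l k  , inj₁ ∘ even-odd-zero l k
... | odd l  | even k = _ , gap-odd-even l k  , inj₂ ∘ odd-even-zero l k
... | odd l  | odd k  = _ , gap-odd-odd l k   , λ ()

wiener-gap : ∀ p q {Δ} → 1 ≤ p → 1 ≤ q →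
  8 * (cycleWiener (2 + p) + cycleWiener (2 + q) + crossSum p q) + Δ ≡
    8 * (cycleWiener (p + q) + 2 * (arcSum (p + q) + (p + q)) + 1) + 8 →
  8 * wiener (F (2 + p + q) (2 + p)) + Δ ≡ 8 * wiener (C3 (2 + p + q))
wiener-gap (suc p) q {Δ} _ 1≤q closed = +-cancelʳ-≡ 8 _ _ (begin
  8 * WF + Δ + 8                                                          ≡⟨ shift WF Δ ⟩
  8 * (WF + 1) + Δ                                                        ≡⟨ cong (λ w → 8 * w + Δ) (wiener-F (suc p) q (s≤s z≤n) 1≤q) ⟩
  8 * (cycleWiener (2 + suc p) + cycleWiener (2 + q) + crossSum (suc p) q) + Δ ≡⟨ closed ⟩
  8 * (cycleWiener (suc p + q) + 2 * (arcSum (suc p + q) + (suc p + q)) + 1) + 8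
    ≡⟨ cong (λ w → 8 * w + 8) (wiener-C3 (p + q) (≤-trans 1≤q (m≤n+m q p))) ⟨
  8 * wiener (C3 (3 + (p + q))) + 8                                       ≡⟨ cong (λ m → 8 * wiener (C3 m) + 8) n≡ ⟩
  8 * wiener (C3 (2 + suc p + q)) + 8                                     ∎)
  where
  open ≡-Reasoning
  WF = wiener (F (2 + suc p + q) (2 + suc p))
  -- Rewriting the order explicitly keeps Agda from comparing the two wiener terms by unfolding them.
  n≡ : 3 + (p + q) ≡ 2 + suc p + q
  n≡ = refl
  shift : ∀ w d → 8 * w + d + 8 ≡ 8 * (w + 1) + d
  shift = solve-∀

wiener-F≤C3 : ∀ p q {n a} → 2 + p ≡ a → a + q ≡ n → 2 ≤ p → 2 ≤ q →
  wiener (F n a) ≤ wiener (C3 n) × (wiener (F n a) ≡ wiener (C3 n) → p ≡ 2 ⊎ q ≡ 2)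
wiener-F≤C3 _ _ refl refl (s≤s (s≤s (z≤n {P}))) (s≤s (s≤s (z≤n {Q}))) =
  let p = suc (suc P)
      q = suc (suc Q)
      Δ , closed , Δ≡0⇒ = gap-by-parity P Q
      8WF+Δ≡8WC = wiener-gap p q (s≤s z≤n) (s≤s z≤n) closed
      8WF = 8 * wiener (F (2 + p + q) (2 + p))
  in *-cancelˡ-≤ 8 (≤-trans (m≤m+n 8WF Δ) (≤-reflexive 8WF+Δ≡8WC)) ,
     λ WF≡WC → Sum.map (cong (2 +_)) (cong (2 +_))
                 (Δ≡0⇒ (+-cancelˡ-≡ 8WF Δ 0 (trans 8WF+Δ≡8WC (trans (cong (8 *_) (sym WF≡WC)) (sym (+-identityʳ 8WF))))))

lemma2 : (n a : ℕ) → 26 ≤ n → 4 ≤ a → a ≤ n ∸ 2 →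
    (wiener (F n a) ≤ wiener (C3 n)) ×
    (wiener (F n a) ≡ wiener (C3 n) → (a ≡ 4) ⊎ (a ≡ n ∸ 2))
-- The comparison holds for every n with 4 ≤ a ≤ n - 2; of 26 ≤ n only 2 ≤ n is used.
lemma2 n a 26≤n 4≤a a≤n∸2 =
  let W≤ , W≡⇒ = wiener-F≤C3 (a ∸ 2) (n ∸ a) {n} {a} (m+[n∸m]≡n 2≤a) n≡ (∸-monoˡ-≤ 2 4≤a) 2≤n∸a
  in W≤ , Sum.map (λ p≡2 → trans (sym (m+[n∸m]≡n 2≤a)) (cong (2 +_) p≡2)) a≡n∸2 ∘ W≡⇒
  where
  2≤n : 2 ≤ n
  2≤n = ≤-trans (s≤s (s≤s z≤n)) 26≤n
  2≤a : 2 ≤ a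
  2≤a = ≤-trans (s≤s (s≤s z≤n)) 4≤a
  n≡ : a + (n ∸ a) ≡ n
  n≡ = m+[n∸m]≡n (≤-trans a≤n∸2 (m∸n≤m n 2))
  2≤n∸a : 2 ≤ n ∸ a
  2≤n∸a = subst (_≤ n ∸ a) (m+n∸m≡n a 2)
            (∸-monoˡ-≤ a (subst (a + 2 ≤_) (m∸n+n≡m 2≤n) (+-monoˡ-≤ 2 a≤n∸2)))
  a≡n∸2 : n ∸ a ≡ 2 → a ≡ n ∸ 2
  a≡n∸2 q≡2 = sym (trans (cong (_∸ 2) (sym n≡)) (trans (cong (λ q → a + q ∸ 2) q≡2) (m+n∸n≡m a 2)))
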